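{- Let $G$ be a graph with loop-edges $e_1,\dots,e_c$. For $\underline n=(n_1,\dots,n_c)$ with all $n_i$ positive integers, let $G^{(\underline n)}$ be the graph obtained from $G$ by inserting $n_i$ new vertices in the interior of $e_i$ for each $i$, and let $\sigma^*:\operatorname{Div}(G)\to\operatorname{Div}(G^{(\underline n)})$ be extension by zero on the new vertices. Then for every $D\in\operatorname{Div}(G)$, $r^{\#}_G(D)=r_{G^{(\underline n)}}(\sigma^*D)$.
   Context: Graphs are finite and connected, loops and multiple edges allowed. $\operatorname{Div}(G)$ is the free abelian group on $V(G)$. For $v\ne w$, $(v\cdot w)$ is the number of edges joining them; $(v\cdot v)=-\operatorname{val}(v)+2\operatorname{loop}(v)$ (valency with loops counted twice, $\operatorname{loop}(v)$ the number of loops at $v$). $T_v=\sum_w(v\cdot w)w$, $\operatorname{Prin}(G)$ is generated by the $T_v$, $D\sim D'$ iff $D-D'\in\operatorname{Prin}(G)$, $|D|$ is the set of effective divisors equivalent to $D$. The rank $r_G(D)$ is $-1$ if $|D|=\emptyset$, otherwise the maximum $k\ge0$ with $|D-E|\ne\emptyset$ for every effective $E$ of degree $k$. Let $\widehat G$ be the graph obtained from $G$ by inserting exactly one new vertex in the interior of each loop-edge, and $\sigma^*:\operatorname{Div}(G)\to\operatorname{Div}(\widehat G)$ extension by zero; define $r^{\#}_G(D):=r_{\widehat G}(\sigma^*D)$. -}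

module Defs where

open import Data.Nat using (ℕ; zero; suc; _<_)
open import Data.Integer as ℤ using (ℤ; +_; -[1+_]; _-_; _*_; _≤_)
open import Data.Fin using (Fin; inject₁; fromℕ) renaming (zero to fzero; suc to fsuc)
open import Data.Fin.Properties using () renaming (_≟_ to _≟ᶠ_)
open import Data.List using (List; []; _∷_; _++_; map; concatMap; allFin; foldr; length; filterᵇ)
open import Data.List.Membership.Propositional using (_∈_)
open import Data.Product using (Σ; _×_; _,_; proj₁; proj₂; ∃)
open import Data.Sum using (_⊎_; inj₁; inj₂)
import Data.Sum.Properties as SumP
import Data.Product.Properties as ProdP
open import Data.Bool using (Bool; true; false; _∧_; _∨_; if_then_else_)
open import Relation.Binary.PropositionalEquality using (_≡_; _≢_)
open import Relation.Binary.Definitions using (DecidableEquality)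
open import Relation.Nullary using (¬_; yes; no)
open import Relation.Nullary.Decidable using (⌊_⌋)
open import Relation.Binary.Construct.Closure.ReflexiveTransitive using (Star)

-- V is the vertex type with decidable equality, `verts` enumerates every
-- vertex exactly once (ensured by construction below), and `edges` is the
-- list of edges (an edge is an unordered pair, stored as an ordered pair;
-- a loop at v is (v , v); repeated entries are multiple edges).

record Graph : Set₁ where
  field
    V     : Set
    _≟_   : DecidableEquality V
    verts : List V
    edges : List (V × V)

module _ (G : Graph) where
  open Graph G

  Σᵥ : (V → ℤ) → ℤ
  Σᵥ f = foldr (λ v s → f v ℤ.+ s) (+ 0) verts

  eqᵇ : V → V → Bool
  eqᵇ u w = ⌊ u ≟ w ⌋

  count : ((V × V) → Bool) → ℕ
  count p = length (filterᵇ p edges)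

  -- number of edges joining v and w (used for v ≠ w)
  joining : V → V → ℕ
  joining v w = count (λ e → (eqᵇ (proj₁ e) v ∧ eqᵇ (proj₂ e) w)
                           ∨ (eqᵇ (proj₁ e) w ∧ eqᵇ (proj₂ e) v))

  loop : V → ℕ
  loop v = count (λ e → eqᵇ (proj₁ e) v ∧ eqᵇ (proj₂ e) v)

  -- valency, loops counted twice
  val : V → ℕ
  val v = count (λ e → eqᵇ (proj₁ e) v) Data.Nat.+ count (λ e → eqᵇ (proj₂ e) v)

  _·_ : V → V → ℤ
  v · w with v ≟ w
  ... | yes _ = ℤ.- (+ val v) ℤ.+ (+ 2) * (+ loop v)
  ... | no  _ = + joining v w

  Div : Set
  Div = V → ℤ

  T : V → Div
  T v w = v · w

  Prin : Div → Set
  Prin D = Σ (V → ℤ) λ a → ∀ w → D w ≡ Σᵥ (λ v → a v * T v w)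

  _-ᴰ_ : Div → Div → Div
  (D -ᴰ D') v = D v - D' v

  _∼_ : Div → Div → Set
  D ∼ D' = Prin (D -ᴰ D')

  Effective : Div → Set
  Effective D = ∀ v → + 0 ≤ D v

  deg : Div → ℤ
  deg D = Σᵥ D

  LinSysNonempty : Div → Set
  LinSysNonempty D = Σ Div λ D' → Effective D' × (D ∼ D')

  RankAtLeast : Div → ℕ → Set
  RankAtLeast D k = ∀ E → Effective E → deg E ≡ + k → LinSysNonempty (D -ᴰ E)

  IsRank : Div → ℤ → Set
  IsRank D r =
      (r ≡ -[1+ 0 ] × ¬ LinSysNonempty D)
    ⊎ Σ ℕ λ k → r ≡ + k × LinSysNonempty D × RankAtLeast D k
                × (∀ k' → k < k' → ¬ RankAtLeast D k')

  Adj : V → V → Set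
  Adj u w = ((u , w) ∈ edges) ⊎ ((w , u) ∈ edges)

  Connected : Set
  Connected = ∀ u w → Star Adj u w

-- The base graph G on vertex set Fin N, given by its non-loop edges
-- `links` and its loop-edges e_1,…,e_c, where loops i is the vertex
-- carrying the loop e_i.

baseGraph : (N : ℕ) → List (Fin N × Fin N) → {c : ℕ} → (Fin c → Fin N) → Graph
baseGraph N links {c} loops = record
  { V = Fin N ; _≟_ = _≟ᶠ_ ; verts = allFin N
  ; edges = links ++ map (λ i → (loops i , loops i)) (allFin c) }

-- vertices of G^(n): old vertices, plus n_i new vertices on loop e_i
SubV : (N c : ℕ) → (Fin c → ℕ) → Set
SubV N c ns = Fin N ⊎ Σ (Fin c) (λ i → Fin (ns i))

-- the path replacing a loop at v when k new vertices (f 0, …, f (k-1))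
-- are inserted:  v - f 0 - f 1 - … - f (k-1) - v   (k = 0: the loop itself)
loopPath : {W : Set} → W → (k : ℕ) → (Fin k → W) → List (W × W)
loopPath v zero    f = (v , v) ∷ []
loopPath v (suc m) f =
  (v , f fzero) ∷ (map (λ j → (f (inject₁ j) , f (fsuc j))) (allFin m)
                    ++ ((f (fromℕ m) , v) ∷ []))

subdivide : (N : ℕ) → List (Fin N × Fin N) → {c : ℕ} → (Fin c → Fin N)
          → (Fin c → ℕ) → Graph
subdivide N links {c} loops ns = record
  { V = SubV N c ns
  ; _≟_ = SumP.≡-dec _≟ᶠ_ (ProdP.≡-dec _≟ᶠ_ _≟ᶠ_)
  ; verts = map inj₁ (allFin N)
            ++ concatMap (λ i → map (λ j → inj₂ (i , j)) (allFin (ns i))) (allFin c)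
  ; edges = map (λ e → (inj₁ (proj₁ e) , inj₁ (proj₂ e))) links
            ++ concatMap (λ i → loopPath (inj₁ (loops i)) (ns i) (λ j → inj₂ (i , j)))
                         (allFin c) }

hatGraph : (N : ℕ) → List (Fin N × Fin N) → {c : ℕ} → (Fin c → Fin N) → Graph
hatGraph N links loops = subdivide N links loops (λ _ → 1)

σ* : {N c : ℕ} {ns : Fin c → ℕ} → (Fin N → ℤ) → SubV N c ns → ℤ
σ* D (inj₁ v) = D v
σ* D (inj₂ _) = + 0

IsRankSharp : (N : ℕ) → List (Fin N × Fin N) → {c : ℕ} → (Fin c → Fin N)
            → (Fin N → ℤ) → ℤ → Set
IsRankSharp N links loops D r = IsRank (hatGraph N links loops) (σ* D) r

module Submission where

-- Let H = G^(ns) with every ns i ≥ 1.  Both "|σ D| ≠ ∅ on H" and "r_H(σ D) ≥ k"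
-- are characterised by conditions on G₀, the base graph with its loops deleted,
-- that do not mention ns; applying this to ns and to (1, …, 1), which gives the
-- graph Ĝ defining r^#, proves the theorem.
--
--  1. On any graph, principal divisors are Laplacians in edge form
--     (principal-is-Laplacian), so linear equivalence is computed edge by edge.
--  2. On H the Laplacian is computed along the closed walks replacing the loops
--     (Lap-old, Lap-new).  Hence the push-forward π X to the base changes by a
--     G₀-Laplacian, and the moment of the chips on the i-th chain changes by a
--     multiple of ns i + 1, so its residue is an invariant.
--  3. Normal form: X ∼ σ (π X) + Σᵢ (chip at the residue position − chip at the base).
--  4. Key theorem: |X| ≠ ∅ on H iff |π X − marks X| ≠ ∅ on G₀, where marks X puts
--     one chip on the base of each loop with nonzero residue.
--  5. Effective divisors of degree k on H correspond to pairs (E₀ , s) on the base,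
--     which turns r_H(σ D) ≥ k into the ns-free condition BaseRankAtLeast.

open import Defs
open import Data.Nat using (ℕ; _≤_)
open import Data.Integer using (ℤ)
open import Data.Fin using (Fin)
open import Data.List using (List)
open import Data.List.Relation.Unary.All using (All)
open import Data.Product using (_×_; proj₁; proj₂)
open import Relation.Binary.PropositionalEquality using (_≢_)
open import Function.Bundles using (_⇔_)

import Data.Nat as ℕ
import Data.Nat.Properties as ℕP
import Data.Integer as ℤ
import Data.Integer.Properties as ℤP
open import Data.Integer using (+_; -[1+_]; _+_; _-_; -_; _*_) renaming (_≤_ to _≤ᶻ_)
open import Data.Integer.DivMod using (a≡a%n+[a/n]*n; n%d<d)
open import Data.Integer.Tactic.RingSolver using (solve-∀)
import Data.Fin.Properties
open import Data.Fin using (toℕ; inject₁) renaming (zero to fzero; suc to fsuc; _≟_ to _≟ᶠ_)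
open import Data.List using ([]; _∷_; _++_; map; concatMap; allFin; foldr; length; filterᵇ; tabulate)
open import Data.List.Properties using (map-tabulate)
open import Data.Product using (Σ; _,_)
open import Data.Sum using (_⊎_; inj₁; inj₂)
import Data.Sum.Properties as SumP
open import Data.Bool using (Bool; true; false; _∧_; _∨_)
open import Data.Empty using (⊥; ⊥-elim)
open import Relation.Binary.PropositionalEquality
  using (_≡_; refl; sym; trans; subst; cong; cong₂; ≢-sym; module ≡-Reasoning)
open import Relation.Binary.Definitions using (DecidableEquality)
open import Relation.Nullary using (yes; no)
open import Relation.Nullary.Decidable using (⌊_⌋)
open import Function using (_∘_; id)
open import Function.Bundles using (mk⇔; Equivalence)
import Function.Properties.Equivalence as ⇔

-- ∑ xs f is the sum of f over the list xs; for the vertex list of a graph it is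
-- definitionally the sum Σᵥ used in the definition of principal divisors.
∑ : {A : Set} → List A → (A → ℤ) → ℤ
∑ xs f = foldr (λ x s → f x + s) (+ 0) xs

module _ {A : Set} where

  ∑-cong : (xs : List A) {f g : A → ℤ} → (∀ x → f x ≡ g x) → ∑ xs f ≡ ∑ xs g
  ∑-cong []       eq = refl
  ∑-cong (x ∷ xs) eq = cong₂ _+_ (eq x) (∑-cong xs eq)

  ∑-++ : (xs ys : List A) (f : A → ℤ) → ∑ (xs ++ ys) f ≡ ∑ xs f + ∑ ys f
  ∑-++ []       ys f = sym (ℤP.+-identityˡ _)
  ∑-++ (x ∷ xs) ys f = trans (cong (_+_ (f x)) (∑-++ xs ys f)) (sym (ℤP.+-assoc (f x) _ _))

  ∑-+ : (xs : List A) (f g : A → ℤ) → ∑ xs (λ x → f x + g x) ≡ ∑ xs f + ∑ xs g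
  ∑-+ []       f g = refl
  ∑-+ (x ∷ xs) f g = trans (cong (_+_ (f x + g x)) (∑-+ xs f g)) (interchange (f x) (g x) _ _)
    where interchange : ∀ a b c d → a + b + (c + d) ≡ a + c + (b + d)
          interchange = solve-∀

  ∑-*ˡ : (xs : List A) (k : ℤ) (f : A → ℤ) → ∑ xs (λ x → k * f x) ≡ k * ∑ xs f
  ∑-*ˡ []       k f = sym (ℤP.*-zeroʳ k)
  ∑-*ˡ (x ∷ xs) k f = trans (cong (_+_ (k * f x)) (∑-*ˡ xs k f)) (sym (ℤP.*-distribˡ-+ k (f x) _))

  ∑-*ʳ : (xs : List A) (k : ℤ) (f : A → ℤ) → ∑ xs (λ x → f x * k) ≡ ∑ xs f * k
  ∑-*ʳ xs k f = trans (∑-cong xs (λ x → ℤP.*-comm (f x) k))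
                      (trans (∑-*ˡ xs k f) (ℤP.*-comm k _))

  ∑-neg : (xs : List A) (f : A → ℤ) → ∑ xs (λ x → - f x) ≡ - ∑ xs f
  ∑-neg []       f = refl
  ∑-neg (x ∷ xs) f = trans (cong (_+_ (- f x)) (∑-neg xs f)) (sym (ℤP.neg-distrib-+ (f x) _))

  ∑-- : (xs : List A) (f g : A → ℤ) → ∑ xs (λ x → f x - g x) ≡ ∑ xs f - ∑ xs g
  ∑-- xs f g = trans (∑-+ xs f (λ x → - g x)) (cong (_+_ (∑ xs f)) (∑-neg xs g))

  ∑-zero : (xs : List A) (f : A → ℤ) → (∀ x → f x ≡ + 0) → ∑ xs f ≡ + 0
  ∑-zero []       f z = refl
  ∑-zero (x ∷ xs) f z = cong₂ _+_ (z x) (∑-zero xs f z)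

  ∑-mono : (xs : List A) (f g : A → ℤ) → (∀ x → f x ≤ᶻ g x) → ∑ xs f ≤ᶻ ∑ xs g
  ∑-mono []       f g le = ℤP.≤-refl
  ∑-mono (x ∷ xs) f g le = ℤP.+-mono-≤ (le x) (∑-mono xs f g le)

  ∑-nonneg : (xs : List A) (f : A → ℤ) → (∀ x → + 0 ≤ᶻ f x) → + 0 ≤ᶻ ∑ xs f
  ∑-nonneg xs f nn = ℤP.≤-trans (ℤP.≤-reflexive (sym (∑-zero xs (λ _ → + 0) (λ _ → refl))))
                                (∑-mono xs (λ _ → + 0) f nn)

module _ {A B : Set} where

  ∑-map : (h : A → B) (xs : List A) (f : B → ℤ) → ∑ (map h xs) f ≡ ∑ xs (f ∘ h)
  ∑-map h []       f = refl
  ∑-map h (x ∷ xs) f = cong (_+_ (f (h x))) (∑-map h xs f)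

  ∑-concatMap : (g : A → List B) (xs : List A) (f : B → ℤ) →
                ∑ (concatMap g xs) f ≡ ∑ xs (λ x → ∑ (g x) f)
  ∑-concatMap g []       f = refl
  ∑-concatMap g (x ∷ xs) f =
    trans (∑-++ (g x) (concatMap g xs) f) (cong (_+_ (∑ (g x) f)) (∑-concatMap g xs f))

  ∑-swap : (xs : List A) (ys : List B) (g : A → B → ℤ) →
           ∑ xs (λ x → ∑ ys (g x)) ≡ ∑ ys (λ y → ∑ xs (λ x → g x y))
  ∑-swap []       ys g = sym (∑-zero ys _ (λ _ → refl))
  ∑-swap (x ∷ xs) ys g =
    trans (cong (_+_ (∑ ys (g x))) (∑-swap xs ys g)) (sym (∑-+ ys (g x) _))

∑-tabulate : {B : Set} (n : ℕ) (h : Fin n → B) (f : B → ℤ) →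
             ∑ (tabulate h) f ≡ ∑ (allFin n) (f ∘ h)
∑-tabulate ℕ.zero    h f = refl
∑-tabulate (ℕ.suc n) h f =
  cong (_+_ (f (h fzero))) (trans (∑-tabulate n (h ∘ fsuc) f) (sym (∑-tabulate n fsuc (f ∘ h))))

∑-allFin-suc : (n : ℕ) (f : Fin (ℕ.suc n) → ℤ) →
               ∑ (allFin (ℕ.suc n)) f ≡ f fzero + ∑ (allFin n) (f ∘ fsuc)
∑-allFin-suc n f = cong (_+_ (f fzero)) (∑-tabulate n fsuc f)

∑< : ℕ → (ℕ → ℤ) → ℤ
∑< ℕ.zero    F = + 0
∑< (ℕ.suc n) F = F 0 + ∑< n (F ∘ ℕ.suc)

∑-toℕ : (n : ℕ) (F : ℕ → ℤ) → ∑ (allFin n) (F ∘ toℕ) ≡ ∑< n F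
∑-toℕ ℕ.zero    F = refl
∑-toℕ (ℕ.suc n) F = trans (∑-allFin-suc n (F ∘ toℕ)) (cong (_+_ (F 0)) (∑-toℕ n (F ∘ ℕ.suc)))

∑<-snoc : (n : ℕ) (F : ℕ → ℤ) → ∑< (ℕ.suc n) F ≡ ∑< n F + F n
∑<-snoc ℕ.zero    F = ℤP.+-comm (F 0) (+ 0)
∑<-snoc (ℕ.suc n) F = trans (cong (_+_ (F 0)) (∑<-snoc n (F ∘ ℕ.suc))) (sym (ℤP.+-assoc (F 0) _ _))

∑<-zero : (n : ℕ) (F : ℕ → ℤ) → (∀ t → F t ≡ + 0) → ∑< n F ≡ + 0
∑<-zero ℕ.zero    F z = refl
∑<-zero (ℕ.suc n) F z = cong₂ _+_ (z 0) (∑<-zero n (F ∘ ℕ.suc) (z ∘ ℕ.suc))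

*-nonneg : ∀ {a b} → + 0 ≤ᶻ a → + 0 ≤ᶻ b → + 0 ≤ᶻ a * b
*-nonneg {+ m} {+ n} _ _ = subst (+ 0 ≤ᶻ_) (ℤP.pos-* m n) (ℤ.+≤+ ℕ.z≤n)

*-monoʳ-≤ : ∀ {a b} y → a ℕ.≤ b → + 0 ≤ᶻ y → + a * y ≤ᶻ + b * y
*-monoʳ-≤ (+ m) a≤b _ = ℤP.*-monoʳ-≤-nonNeg (+ m) (ℤ.+≤+ a≤b)

⟦_⟧ : Bool → ℤ
⟦ true  ⟧ = + 1
⟦ false ⟧ = + 0

⟦⟧-nonneg : ∀ b → + 0 ≤ᶻ ⟦ b ⟧
⟦⟧-nonneg true  = ℤ.+≤+ ℕ.z≤n
⟦⟧-nonneg false = ℤ.+≤+ ℕ.z≤n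

⟦∧⟧ : ∀ b c → ⟦ b ∧ c ⟧ ≡ ⟦ b ⟧ * ⟦ c ⟧
⟦∧⟧ true  c = sym (ℤP.*-identityˡ ⟦ c ⟧)
⟦∧⟧ false c = sym (ℤP.*-zeroˡ ⟦ c ⟧)

⟦∨⟧-exclusive : ∀ a b c d → (a ≡ true → c ≡ true → ⊥) →
                ⟦ (a ∧ b) ∨ (c ∧ d) ⟧ ≡ ⟦ a ⟧ * ⟦ b ⟧ + ⟦ c ⟧ * ⟦ d ⟧
⟦∨⟧-exclusive true  b     true  d     ex = ⊥-elim (ex refl refl)
⟦∨⟧-exclusive true  true  false d     ex = refl
⟦∨⟧-exclusive true  false false d     ex = refl
⟦∨⟧-exclusive false b     true  true  ex = refl
⟦∨⟧-exclusive false b     true  false ex = refl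
⟦∨⟧-exclusive false b     false d     ex = refl

count-∑ : {A : Set} (p : A → Bool) (xs : List A) →
          + length (filterᵇ p xs) ≡ ∑ xs (λ x → ⟦ p x ⟧)
count-∑ p []       = refl
count-∑ p (x ∷ xs) with p x
... | true  = trans (ℤP.pos-+ 1 (length (filterᵇ p xs))) (cong (_+_ (+ 1)) (count-∑ p xs))
... | false = trans (count-∑ p xs) (sym (ℤP.+-identityˡ _))

module Kronecker {A : Set} (_≟_ : DecidableEquality A) where

  δ : A → A → ℤ
  δ x y = ⟦ ⌊ x ≟ y ⌋ ⟧

  ≟-sound : ∀ {x y} → ⌊ x ≟ y ⌋ ≡ true → x ≡ y
  ≟-sound {x} {y} eq with x ≟ y | eq
  ... | yes x≡y | _ = x≡y
  ... | no  _   | ()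

  δ-refl : ∀ x → δ x x ≡ + 1
  δ-refl x with x ≟ x
  ... | yes _   = refl
  ... | no  x≢x = ⊥-elim (x≢x refl)

  δ-≢ : ∀ {x y} → x ≢ y → δ x y ≡ + 0
  δ-≢ {x} {y} x≢y with x ≟ y
  ... | yes x≡y = ⊥-elim (x≢y x≡y)
  ... | no  _   = refl

  δ-sym : ∀ x y → δ x y ≡ δ y x
  δ-sym x y with x ≟ y
  ... | yes refl = sym (δ-refl x)
  ... | no  x≢y  = sym (δ-≢ (≢-sym x≢y))

  δ-nonneg : ∀ x y → + 0 ≤ᶻ δ x y
  δ-nonneg x y = ⟦⟧-nonneg ⌊ x ≟ y ⌋

  δ-subst : (f : A → ℤ) → ∀ x y → f y * δ x y ≡ f x * δ x y
  δ-subst f x y with x ≟ y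
  ... | yes refl = refl
  ... | no  _    = trans (ℤP.*-zeroʳ (f y)) (sym (ℤP.*-zeroʳ (f x)))

-- Case distinction on equality that, unlike `with x ≟ y`, does not abstract the
-- decision procedure out of Kronecker deltas in the goal.
≡⊎≢ : {A : Set} → DecidableEquality A → (x y : A) → x ≡ y ⊎ x ≢ y
≡⊎≢ _≟_ x y with x ≟ y
... | yes x≡y = inj₁ x≡y
... | no  x≢y = inj₂ x≢y

δ-injective : {A B : Set} (_≟A_ : DecidableEquality A) (_≟B_ : DecidableEquality B)
              (f : A → B) → (∀ {x y} → f x ≡ f y → x ≡ y) →
              ∀ x y → Kronecker.δ _≟B_ (f x) (f y) ≡ Kronecker.δ _≟A_ x y
δ-injective _≟A_ _≟B_ f inj x y with x ≟A y
... | yes refl = Kronecker.δ-refl _≟B_ (f x)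
... | no  x≢y  = Kronecker.δ-≢ _≟B_ (λ fx≡fy → x≢y (inj fx≡fy))

open module Kᶠ {n : ℕ} = Kronecker (_≟ᶠ_ {n}) using ()
  renaming (δ to δᶠ; δ-refl to δᶠ-refl; δ-≢ to δᶠ-≢; δ-sym to δᶠ-sym; δ-nonneg to δᶠ-nonneg)

δᶠ-suc : ∀ {n} (j k : Fin n) → δᶠ (fsuc j) (fsuc k) ≡ δᶠ j k
δᶠ-suc = δ-injective _≟ᶠ_ _≟ᶠ_ fsuc Data.Fin.Properties.suc-injective

sift-allFin : ∀ n (g : Fin n → ℤ) y → ∑ (allFin n) (λ x → δᶠ y x * g x) ≡ g y
sift-allFin (ℕ.suc n) g fzero = begin
    ∑ (allFin (ℕ.suc n)) (λ x → δᶠ fzero x * g x)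
  ≡⟨ ∑-allFin-suc n (λ x → δᶠ fzero x * g x) ⟩
    + 1 * g fzero + ∑ (allFin n) (λ x → + 0 * g (fsuc x))
  ≡⟨ cong₂ _+_ (ℤP.*-identityˡ (g fzero)) (∑-zero (allFin n) _ (λ x → ℤP.*-zeroˡ (g (fsuc x)))) ⟩
    g fzero + + 0
  ≡⟨ ℤP.+-identityʳ (g fzero) ⟩
    g fzero ∎
  where open ≡-Reasoning
sift-allFin (ℕ.suc n) g (fsuc y) = begin
    ∑ (allFin (ℕ.suc n)) (λ x → δᶠ (fsuc y) x * g x)
  ≡⟨ ∑-allFin-suc n (λ x → δᶠ (fsuc y) x * g x) ⟩
    + 0 * g fzero + ∑ (allFin n) (λ x → δᶠ (fsuc y) (fsuc x) * g (fsuc x))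
  ≡⟨ cong₂ _+_ (ℤP.*-zeroˡ (g fzero))
               (∑-cong (allFin n) (λ x → cong (_* g (fsuc x)) (δᶠ-suc y x))) ⟩
    + 0 + ∑ (allFin n) (λ x → δᶠ y x * g (fsuc x))
  ≡⟨ trans (ℤP.+-identityˡ _) (sift-allFin n (g ∘ fsuc) y) ⟩
    g (fsuc y) ∎
  where open ≡-Reasoning

-- Kronecker delta on ℕ; it computes by recursion on both arguments.
δℕ : ℕ → ℕ → ℤ
δℕ s t = ⟦ s ℕ.≡ᵇ t ⟧

δℕ-refl : ∀ t → δℕ t t ≡ + 1
δℕ-refl ℕ.zero    = refl
δℕ-refl (ℕ.suc t) = δℕ-refl t

δℕ-≢ : ∀ s t → s ≢ t → δℕ s t ≡ + 0
δℕ-≢ ℕ.zero    ℕ.zero    s≢t = ⊥-elim (s≢t refl)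
δℕ-≢ ℕ.zero    (ℕ.suc t) s≢t = refl
δℕ-≢ (ℕ.suc s) ℕ.zero    s≢t = refl
δℕ-≢ (ℕ.suc s) (ℕ.suc t) s≢t = δℕ-≢ s t (s≢t ∘ cong ℕ.suc)

δℕ-sym : ∀ s t → δℕ s t ≡ δℕ t s
δℕ-sym ℕ.zero    ℕ.zero    = refl
δℕ-sym ℕ.zero    (ℕ.suc t) = refl
δℕ-sym (ℕ.suc s) ℕ.zero    = refl
δℕ-sym (ℕ.suc s) (ℕ.suc t) = δℕ-sym s t

δℕ-nonneg : ∀ s t → + 0 ≤ᶻ δℕ s t
δℕ-nonneg s t = ⟦⟧-nonneg (s ℕ.≡ᵇ t)

δℕ-toℕ : ∀ {n} (j k : Fin n) → δℕ (toℕ j) (toℕ k) ≡ δᶠ j k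
δℕ-toℕ j k with ≡⊎≢ _≟ᶠ_ j k
... | inj₁ refl = trans (δℕ-refl (toℕ j)) (sym (δᶠ-refl j))
... | inj₂ j≢k  = trans (δℕ-≢ _ _ (j≢k ∘ Data.Fin.Properties.toℕ-injective)) (sym (δᶠ-≢ j≢k))

-- For h : Fin n → ℤ and b : ℤ, `along n h b` is the
-- sequence h 0, …, h (n-1), b, b, … and `around n h b` is b followed by it: the
-- values of a function at the consecutive vertices u, F 0, …, F (n-1), u of the
-- closed walk through a subdivided loop at u (with h = a ∘ F and b = a u).
along : (n : ℕ) → (Fin n → ℤ) → ℤ → ℕ → ℤ
along ℕ.zero    h b t         = b
along (ℕ.suc n) h b ℕ.zero    = h fzero
along (ℕ.suc n) h b (ℕ.suc t) = along n (h ∘ fsuc) b t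

around : (n : ℕ) → (Fin n → ℤ) → ℤ → ℕ → ℤ
around n h b ℕ.zero    = b
around n h b (ℕ.suc t) = along n h b t

along-< : ∀ n (F : ℕ → ℤ) b t → t ℕ.< n → along n (F ∘ toℕ) b t ≡ F t
along-< (ℕ.suc n) F b ℕ.zero    _             = refl
along-< (ℕ.suc n) F b (ℕ.suc t) (ℕ.s≤s t<n) = along-< n (F ∘ ℕ.suc) b t t<n

along-≥ : ∀ n (F : ℕ → ℤ) b t → n ℕ.≤ t → along n (F ∘ toℕ) b t ≡ b
along-≥ ℕ.zero    F b t         _            = refl
along-≥ (ℕ.suc n) F b (ℕ.suc t) (ℕ.s≤s n≤t) = along-≥ n (F ∘ ℕ.suc) b t n≤t

along-const : ∀ n x t → along n (λ _ → x) x t ≡ x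
along-const ℕ.zero    x t         = refl
along-const (ℕ.suc n) x ℕ.zero    = refl
along-const (ℕ.suc n) x (ℕ.suc t) = along-const n x t

along-end : ∀ n h b → along n h b n ≡ b
along-end ℕ.zero    h b = refl
along-end (ℕ.suc n) h b = along-end n (h ∘ fsuc) b

∑<-second-difference : ∀ n (A : ℕ → ℤ) →
  ∑< n (λ t → A t - + 2 * A (ℕ.suc t) + A (ℕ.suc (ℕ.suc t))) ≡ (A (ℕ.suc n) - A n) - (A 1 - A 0)
∑<-second-difference ℕ.zero A = cancel (A 0) (A 1)
  where cancel : ∀ a b → + 0 ≡ (b - a) - (b - a)
        cancel = solve-∀
∑<-second-difference (ℕ.suc n) A =
  trans (cong (_+_ (A 0 - + 2 * A 1 + A 2)) (∑<-second-difference n (A ∘ ℕ.suc)))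
        (collect (A 0) (A 1) (A 2) (A (ℕ.suc n)) (A (ℕ.suc (ℕ.suc n))))
  where collect : ∀ a b c x y → a - + 2 * b + c + ((y - x) - (c - b)) ≡ (y - x) - (b - a)
        collect = solve-∀

∑<-weighted-second-difference : ∀ n (A : ℕ → ℤ) →
  ∑< n (λ t → (+ 1 + + t) * (A t - + 2 * A (ℕ.suc t) + A (ℕ.suc (ℕ.suc t))))
  ≡ + n * (A (ℕ.suc n) - A n) - (A n - A 0)
∑<-weighted-second-difference ℕ.zero A = cancel (A 0) (A 1)
  where cancel : ∀ a b → + 0 ≡ + 0 * (b - a) - (a - a)
        cancel = solve-∀
∑<-weighted-second-difference (ℕ.suc n) A =
  trans (∑<-snoc n _)
        (trans (cong (_+ (+ 1 + + n) * (A n - + 2 * A (ℕ.suc n) + A (ℕ.suc (ℕ.suc n))))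
                     (∑<-weighted-second-difference n A))
               (collect (+ n) (A 0) (A n) (A (ℕ.suc n)) (A (ℕ.suc (ℕ.suc n)))))
  where collect : ∀ m a₀ a b c → m * (b - a) - (a - a₀) + (+ 1 + m) * (a - + 2 * b + c)
                                 ≡ (+ 1 + m) * (c - b) - (b - a₀)
        collect = solve-∀

-- Principal divisors as Laplacians, for an arbitrary graph

module Laplacian (G : Graph) where
  open Graph G
  open Kronecker _≟_ public

  -- What firing the function a along the edge (p , q) changes at the vertex w.
  edgeFlow : (V → ℤ) → V × V → V → ℤ
  edgeFlow a (p , q) w = (a q - a p) * (δ p w - δ q w)

  Lap : (V → ℤ) → V → ℤ
  Lap a w = ∑ edges (λ e → edgeFlow a e w)

  -- The vertex list enumerates every vertex exactly once, expressed as the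
  -- sifting property of δ.
  Sifting : Set
  Sifting = ∀ (g : V → ℤ) y → ∑ verts (λ x → δ y x * g x) ≡ g y

  -- Contribution of the edge (p , q) to the intersection number (v · w).
  incidence : V × V → V → V → ℤ
  incidence (p , q) v w = δ p v * δ q w + δ q v * δ p w - δ w v * (δ p w + δ q w)

  private
    incidence-diagonal : ∀ v e → - (⟦ eqᵇ G (proj₁ e) v ⟧ + ⟦ eqᵇ G (proj₂ e) v ⟧)
                                 + + 2 * ⟦ eqᵇ G (proj₁ e) v ∧ eqᵇ G (proj₂ e) v ⟧
                               ≡ incidence e v v
    incidence-diagonal v (p , q)
      rewrite ⟦∧⟧ (eqᵇ G p v) (eqᵇ G q v) | δ-refl v = rearrange (δ p v) (δ q v)
      where rearrange : ∀ a b → - (a + b) + + 2 * (a * b) ≡ a * b + b * a - + 1 * (a + b)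
            rearrange = solve-∀

    incidence-off-diagonal : ∀ {v w} → v ≢ w → ∀ e →
      ⟦ (eqᵇ G (proj₁ e) v ∧ eqᵇ G (proj₂ e) w) ∨ (eqᵇ G (proj₁ e) w ∧ eqᵇ G (proj₂ e) v) ⟧
      ≡ incidence e v w
    incidence-off-diagonal {v} {w} v≢w (p , q)
      rewrite ⟦∨⟧-exclusive (eqᵇ G p v) (eqᵇ G q w) (eqᵇ G p w) (eqᵇ G q v)
                (λ p≡v p≡w → v≢w (trans (sym (≟-sound p≡v)) (≟-sound p≡w)))
            | δ-≢ (≢-sym v≢w) = rearrange (δ p v) (δ q w) (δ p w) (δ q v)
      where rearrange : ∀ a b c d → a * b + c * d ≡ a * b + d * c - + 0 * (c + b)
            rearrange = solve-∀

  dot-as-incidence : ∀ v w → _·_ G v w ≡ ∑ edges (λ e → incidence e v w)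
  dot-as-incidence v w with v ≟ w
  ... | yes refl = begin
      - (+ (count G (λ e → eqᵇ G (proj₁ e) v) ℕ.+ count G (λ e → eqᵇ G (proj₂ e) v)))
        + + 2 * + loop G v
    ≡⟨ cong₂ (λ s l → - s + + 2 * l)
             (trans (ℤP.pos-+ (count G _) _) (cong₂ _+_ (count-∑ _ edges) (count-∑ _ edges)))
             (count-∑ _ edges) ⟩
      - (∑ edges f + ∑ edges g) + + 2 * ∑ edges h
    ≡⟨ sym (trans (∑-+ edges (λ e → - (f e + g e)) (λ e → + 2 * h e))
                  (cong₂ _+_ (trans (∑-neg edges (λ e → f e + g e)) (cong -_ (∑-+ edges f g)))
                             (∑-*ˡ edges (+ 2) h))) ⟩
      ∑ edges (λ e → - (f e + g e) + + 2 * h e)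
    ≡⟨ ∑-cong edges (incidence-diagonal v) ⟩
      ∑ edges (λ e → incidence e v v) ∎
    where
    open ≡-Reasoning
    f g h : V × V → ℤ
    f e = ⟦ eqᵇ G (proj₁ e) v ⟧
    g e = ⟦ eqᵇ G (proj₂ e) v ⟧
    h e = ⟦ eqᵇ G (proj₁ e) v ∧ eqᵇ G (proj₂ e) v ⟧
  ... | no v≢w = trans (count-∑ _ edges) (∑-cong edges (incidence-off-diagonal v≢w))

  incidence-sifted : Sifting → ∀ a e w → ∑ verts (λ v → a v * incidence e v w) ≡ edgeFlow a e w
  incidence-sifted sift a (p , q) w = begin
      ∑ verts (λ v → a v * incidence (p , q) v w)
    ≡⟨ ∑-cong verts (λ v → distribute (a v) (δ p v) (δ q v) (δ w v) (δ p w) (δ q w)) ⟩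
      ∑ verts (λ v → δ p v * (a v * δ q w) + δ q v * (a v * δ p w) - δ w v * (a v * (δ p w + δ q w)))
    ≡⟨ trans (∑-- verts (λ v → δ p v * (a v * δ q w) + δ q v * (a v * δ p w))
                     (λ v → δ w v * (a v * (δ p w + δ q w))))
             (cong (_- ∑ verts (λ v → δ w v * (a v * (δ p w + δ q w))))
                   (∑-+ verts (λ v → δ p v * (a v * δ q w)) (λ v → δ q v * (a v * δ p w)))) ⟩
      ∑ verts (λ v → δ p v * (a v * δ q w)) + ∑ verts (λ v → δ q v * (a v * δ p w))
        - ∑ verts (λ v → δ w v * (a v * (δ p w + δ q w)))
    ≡⟨ cong₂ _-_ (cong₂ _+_ (sift (λ v → a v * δ q w) p) (sift (λ v → a v * δ p w) q))
                 (sift (λ v → a v * (δ p w + δ q w)) w) ⟩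
      a p * δ q w + a q * δ p w - a w * (δ p w + δ q w)
    ≡⟨ cong (λ t → a p * δ q w + a q * δ p w - t)
            (trans (ℤP.*-distribˡ-+ (a w) (δ p w) (δ q w))
                   (cong₂ _+_ (δ-subst a p w) (δ-subst a q w))) ⟩
      a p * δ q w + a q * δ p w - (a p * δ p w + a q * δ q w)
    ≡⟨ collect (a p) (a q) (δ p w) (δ q w) ⟩
      edgeFlow a (p , q) w ∎
    where
    open ≡-Reasoning
    distribute : ∀ x P Q W Pw Qw → x * (P * Qw + Q * Pw - W * (Pw + Qw))
                 ≡ P * (x * Qw) + Q * (x * Pw) - W * (x * (Pw + Qw))
    distribute = solve-∀
    collect : ∀ ap aq Pw Qw → ap * Qw + aq * Pw - (ap * Pw + aq * Qw) ≡ (aq - ap) * (Pw - Qw)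
    collect = solve-∀

  principal-is-Laplacian : Sifting → ∀ a w → Σᵥ G (λ v → a v * T G v w) ≡ Lap a w
  principal-is-Laplacian sift a w = begin
      ∑ verts (λ v → a v * _·_ G v w)
    ≡⟨ ∑-cong verts (λ v → cong (_*_ (a v)) (dot-as-incidence v w)) ⟩
      ∑ verts (λ v → a v * ∑ edges (λ e → incidence e v w))
    ≡⟨ ∑-cong verts (λ v → sym (∑-*ˡ edges (a v) _)) ⟩
      ∑ verts (λ v → ∑ edges (λ e → a v * incidence e v w))
    ≡⟨ ∑-swap verts edges (λ v e → a v * incidence e v w) ⟩
      ∑ edges (λ e → ∑ verts (λ v → a v * incidence e v w))
    ≡⟨ ∑-cong edges (λ e → incidence-sifted sift a e w) ⟩
      Lap a w ∎
    where open ≡-Reasoning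

  Lap-+ : ∀ a b w → Lap (λ v → a v + b v) w ≡ Lap a w + Lap b w
  Lap-+ a b w = trans (∑-cong edges flow-+) (∑-+ edges (λ e → edgeFlow a e w) (λ e → edgeFlow b e w))
    where
    flow-+ : ∀ e → edgeFlow (λ v → a v + b v) e w ≡ edgeFlow a e w + edgeFlow b e w
    flow-+ (p , q) = distrib (a q) (a p) (b q) (b p) (δ p w - δ q w)
      where distrib : ∀ aq ap bq bp d → (aq + bq - (ap + bp)) * d ≡ (aq - ap) * d + (bq - bp) * d
            distrib = solve-∀

  Lap-* : ∀ k a w → Lap (λ v → k * a v) w ≡ k * Lap a w
  Lap-* k a w = trans (∑-cong edges flow-*) (∑-*ˡ edges k (λ e → edgeFlow a e w))
    where
    flow-* : ∀ e → edgeFlow (λ v → k * a v) e w ≡ k * edgeFlow a e w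
    flow-* (p , q) = assoc k (a q) (a p) (δ p w - δ q w)
      where assoc : ∀ k aq ap d → (k * aq - k * ap) * d ≡ k * ((aq - ap) * d)
            assoc = solve-∀

  Lap-∑ : {I : Set} (xs : List I) (a : I → V → ℤ) → ∀ w →
          Lap (λ v → ∑ xs (λ x → a x v)) w ≡ ∑ xs (λ x → Lap (a x) w)
  Lap-∑ xs a w = trans (∑-cong edges flow-∑) (∑-swap edges xs (λ e x → edgeFlow (a x) e w))
    where
    flow-∑ : ∀ e → edgeFlow (λ v → ∑ xs (λ x → a x v)) e w ≡ ∑ xs (λ x → edgeFlow (a x) e w)
    flow-∑ (p , q) = trans (cong (_* (δ p w - δ q w)) (sym (∑-- xs (λ x → a x q) (λ x → a x p))))
                           (sym (∑-*ʳ xs (δ p w - δ q w) (λ x → a x q - a x p)))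

  Lap-zero : ∀ a w → (∀ v → a v ≡ + 0) → Lap a w ≡ + 0
  Lap-zero a w z = ∑-zero edges _ flow-zero
    where
    flow-zero : ∀ e → edgeFlow a e w ≡ + 0
    flow-zero (p , q) rewrite z p | z q = ℤP.*-zeroˡ (δ p w - δ q w)

  infix 4 _≈_
  _≈_ : (V → ℤ) → (V → ℤ) → Set
  X ≈ Y = Σ (V → ℤ) λ a → ∀ w → X w - Y w ≡ Lap a w

  ≈-reflexive : ∀ {X Y} → (∀ w → X w ≡ Y w) → X ≈ Y
  ≈-reflexive {X} {Y} eq = (λ _ → + 0) , λ w →
    trans (cong (_-_ (X w)) (sym (eq w)))
          (trans (ℤP.+-inverseʳ (X w)) (sym (Lap-zero (λ _ → + 0) w (λ _ → refl))))

  ≈-refl : ∀ {X} → X ≈ X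
  ≈-refl {X} = ≈-reflexive {X} {X} (λ _ → refl)

  ≈-sym : ∀ {X Y} → X ≈ Y → Y ≈ X
  ≈-sym {X} {Y} (a , eq) = (λ v → - + 1 * a v) , λ w →
    trans (negate (X w) (Y w)) (trans (cong (_*_ (- + 1)) (eq w)) (sym (Lap-* (- + 1) a w)))
    where negate : ∀ x y → y - x ≡ - + 1 * (x - y)
          negate = solve-∀

  ≈-trans : ∀ {X Y Z} → X ≈ Y → Y ≈ Z → X ≈ Z
  ≈-trans {X} {Y} {Z} (a , eq) (b , eq′) = (λ v → a v + b v) , λ w →
    trans (split (X w) (Y w) (Z w)) (trans (cong₂ _+_ (eq w) (eq′ w)) (sym (Lap-+ a b w)))
    where split : ∀ x y z → x - z ≡ (x - y) + (y - z)
          split = solve-∀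

  ≈-+ : ∀ {X Y X′ Y′} → X ≈ Y → X′ ≈ Y′ → (λ w → X w + X′ w) ≈ (λ w → Y w + Y′ w)
  ≈-+ {X} {Y} {X′} {Y′} (a , eq) (b , eq′) = (λ v → a v + b v) , λ w →
    trans (interchange (X w) (Y w) (X′ w) (Y′ w))
          (trans (cong₂ _+_ (eq w) (eq′ w)) (sym (Lap-+ a b w)))
    where interchange : ∀ x y x′ y′ → x + x′ - (y + y′) ≡ (x - y) + (x′ - y′)
          interchange = solve-∀

  ≈-* : ∀ k {X Y} → X ≈ Y → (λ w → k * X w) ≈ (λ w → k * Y w)
  ≈-* k {X} {Y} (a , eq) = (λ v → k * a v) , λ w →
    trans (factor k (X w) (Y w)) (trans (cong (k *_) (eq w)) (sym (Lap-* k a w)))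
    where factor : ∀ k x y → k * x - k * y ≡ k * (x - y)
          factor = solve-∀

  ≈-∑ : {I : Set} (xs : List I) (X Y : I → V → ℤ) → (∀ x → X x ≈ Y x) →
        (λ w → ∑ xs (λ x → X x w)) ≈ (λ w → ∑ xs (λ x → Y x w))
  ≈-∑ xs X Y eqs = (λ v → ∑ xs (λ x → proj₁ (eqs x) v)) , λ w →
    trans (sym (∑-- xs (λ x → X x w) (λ x → Y x w)))
          (trans (∑-cong xs (λ x → proj₂ (eqs x) w)) (sym (Lap-∑ xs (λ x → proj₁ (eqs x)) w)))

  HasEffective : (V → ℤ) → Set
  HasEffective X = Σ (V → ℤ) λ Y → (∀ v → + 0 ≤ᶻ Y v) × X ≈ Y

  HasEffective-reflexive : ∀ {X X′} → (∀ w → X w ≡ X′ w) → HasEffective X → HasEffective X′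
  HasEffective-reflexive X≡X′ (Y , effective , a , eq) =
    Y , effective , a , λ w → trans (cong (_- Y w) (sym (X≡X′ w))) (eq w)

  linSys⇔hasEffective : Sifting → ∀ X → LinSysNonempty G X ⇔ HasEffective X
  linSys⇔hasEffective sift X = mk⇔
    (λ { (Y , effective , a , eq) → Y , effective , a , λ w → trans (eq w) (principal-is-Laplacian sift a w) })
    (λ { (Y , effective , a , eq) → Y , effective , a , λ w → trans (eq w) (sym (principal-is-Laplacian sift a w)) })

  loopPath-peel : ∀ m (F : Fin (ℕ.suc (ℕ.suc m)) → V) u (h : V × V → ℤ) →
    ∑ (loopPath u (ℕ.suc (ℕ.suc m)) F) h
    ≡ h (u , F fzero) + h (F fzero , F (fsuc fzero))
      + (∑ (loopPath u (ℕ.suc m) (F ∘ fsuc)) h - h (u , F (fsuc fzero)))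
  loopPath-peel m F u h
    rewrite map-tabulate {n = m} fsuc (λ j → (F (inject₁ j) , F (fsuc j)))
          | map-tabulate {n = m} id (λ j → (F (fsuc (inject₁ j)) , F (fsuc (fsuc j)))) =
    rearrange (h (u , F fzero)) (h (F fzero , F (fsuc fzero))) (h (u , F (fsuc fzero))) _
    where rearrange : ∀ a b c R → a + (b + R) ≡ a + b + ((c + R) - c)
          rearrange = solve-∀

  flow-away : ∀ a p q w → δ p w ≡ + 0 → δ q w ≡ + 0 → edgeFlow a (p , q) w ≡ + 0
  flow-away a p q w p≢w q≢w rewrite p≢w | q≢w = ℤP.*-zeroʳ (a q - a p)

  loopFlow-away : ∀ n (F : Fin n → V) u a w → δ u w ≡ + 0 → (∀ j → δ (F j) w ≡ + 0) →
                  ∑ (loopPath u n F) (λ e → edgeFlow a e w) ≡ + 0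
  loopFlow-away ℕ.zero F u a w u≢w F≢w rewrite flow-away a u u w u≢w u≢w = refl
  loopFlow-away (ℕ.suc ℕ.zero) F u a w u≢w F≢w
    rewrite flow-away a u (F fzero) w u≢w (F≢w fzero) | flow-away a (F fzero) u w (F≢w fzero) u≢w = refl
  loopFlow-away (ℕ.suc (ℕ.suc m)) F u a w u≢w F≢w =
    trans (loopPath-peel m F u (λ e → edgeFlow a e w))
          (vanish (flow-away a u (F fzero) w u≢w (F≢w fzero))
                  (flow-away a (F fzero) (F (fsuc fzero)) w (F≢w fzero) (F≢w (fsuc fzero)))
                  (loopFlow-away (ℕ.suc m) (F ∘ fsuc) u a w u≢w (F≢w ∘ fsuc))
                  (flow-away a u (F (fsuc fzero)) w u≢w (F≢w (fsuc fzero))))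
    where vanish : ∀ {x y R z} → x ≡ + 0 → y ≡ + 0 → R ≡ + 0 → z ≡ + 0 → x + y + (R - z) ≡ + 0
          vanish refl refl refl refl = refl

  loopFlow-base : ∀ n (F : Fin n → V) u a → (∀ j → δ (F j) u ≡ + 0) → δ u u ≡ + 1 →
    ∑ (loopPath u n F) (λ e → edgeFlow a e u)
    ≡ around n (a ∘ F) (a u) 1 + around n (a ∘ F) (a u) n - + 2 * a u
  loopFlow-base ℕ.zero F u a F≢u u≡u rewrite u≡u = flat (a u)
    where flat : ∀ x → (x - x) * (+ 1 - + 1) + + 0 ≡ x + x - + 2 * x
          flat = solve-∀
  loopFlow-base (ℕ.suc ℕ.zero) F u a F≢u u≡u rewrite u≡u | F≢u fzero = two-edges (a u) (a (F fzero))
    where two-edges : ∀ x y → (y - x) * (+ 1 - + 0) + ((x - y) * (+ 0 - + 1) + + 0) ≡ y + y - + 2 * x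
          two-edges = solve-∀
  loopFlow-base (ℕ.suc (ℕ.suc m)) F u a F≢u u≡u =
    trans (loopPath-peel m F u (λ e → edgeFlow a e u))
          (extend (loopFlow-base (ℕ.suc m) (F ∘ fsuc) u a (F≢u ∘ fsuc) u≡u))
    where
    A : ℕ → ℤ
    A = around (ℕ.suc m) (a ∘ F ∘ fsuc) (a u)
    extend : ∑ (loopPath u (ℕ.suc m) (F ∘ fsuc)) (λ e → edgeFlow a e u) ≡ A 1 + A (ℕ.suc m) - + 2 * a u →
             edgeFlow a (u , F fzero) u + edgeFlow a (F fzero , F (fsuc fzero)) u
               + (∑ (loopPath u (ℕ.suc m) (F ∘ fsuc)) (λ e → edgeFlow a e u) - edgeFlow a (u , F (fsuc fzero)) u)
             ≡ around (ℕ.suc (ℕ.suc m)) (a ∘ F) (a u) 1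
               + around (ℕ.suc (ℕ.suc m)) (a ∘ F) (a u) (ℕ.suc (ℕ.suc m)) - + 2 * a u
    extend ih rewrite ih | u≡u | F≢u fzero | F≢u (fsuc fzero) =
      step (a u) (a (F fzero)) (a (F (fsuc fzero))) (along (ℕ.suc m) (a ∘ F ∘ fsuc) (a u) m)
      where step : ∀ x y z v → (y - x) * (+ 1 - + 0) + (z - y) * (+ 0 - + 0)
                                 + (z + v - + 2 * x - (z - x) * (+ 1 - + 0))
                               ≡ y + v - + 2 * x
            step = solve-∀

  loopFlow-inner : ∀ n (F : Fin n → V) u a (k : Fin n) →
    (∀ j → δ (F j) (F k) ≡ δᶠ j k) → δ u (F k) ≡ + 0 →
    let A = around n (a ∘ F) (a u) in
    ∑ (loopPath u n F) (λ e → edgeFlow a e (F k))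
    ≡ A (toℕ k) - + 2 * A (ℕ.suc (toℕ k)) + A (ℕ.suc (ℕ.suc (toℕ k)))
  loopFlow-inner (ℕ.suc ℕ.zero) F u a fzero F≡Fk u≢Fk rewrite u≢Fk | F≡Fk fzero =
    two-edges (a u) (a (F fzero))
    where two-edges : ∀ x y → (y - x) * (+ 0 - + 1) + ((x - y) * (+ 1 - + 0) + + 0) ≡ x - + 2 * y + x
          two-edges = solve-∀
  loopFlow-inner (ℕ.suc (ℕ.suc m)) F u a fzero F≡Fk u≢Fk
    rewrite loopPath-peel m F u (λ e → edgeFlow a e (F fzero))
          | loopFlow-away (ℕ.suc m) (F ∘ fsuc) u a (F fzero) u≢Fk (F≡Fk ∘ fsuc)
          | u≢Fk | F≡Fk fzero | F≡Fk (fsuc fzero) =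
    first-vertex (a u) (a (F fzero)) (a (F (fsuc fzero)))
    where first-vertex : ∀ x y z → (y - x) * (+ 0 - + 1) + (z - y) * (+ 1 - + 0) + (+ 0 - (z - x) * (+ 0 - + 0))
                                   ≡ x - + 2 * y + z
          first-vertex = solve-∀
  loopFlow-inner (ℕ.suc (ℕ.suc m)) F u a (fsuc k) F≡Fk u≢Fk =
    trans (loopPath-peel m F u (λ e → edgeFlow a e (F (fsuc k))))
          (extend k F≡Fk u≢Fk (loopFlow-inner (ℕ.suc m) (F ∘ fsuc) u a k
                                 (λ j → trans (F≡Fk (fsuc j)) (δᶠ-suc j k)) u≢Fk))
    where
    A′ : ℕ → ℤ
    A′ = along (ℕ.suc m) (a ∘ F ∘ fsuc) (a u)
    extend : ∀ (k : Fin (ℕ.suc m)) → (∀ j → δ (F j) (F (fsuc k)) ≡ δᶠ j (fsuc k)) → δ u (F (fsuc k)) ≡ + 0 →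
      let A  = around (ℕ.suc (ℕ.suc m)) (a ∘ F) (a u)
          B  = around (ℕ.suc m) (a ∘ F ∘ fsuc) (a u) in
      ∑ (loopPath u (ℕ.suc m) (F ∘ fsuc)) (λ e → edgeFlow a e (F (fsuc k)))
        ≡ B (toℕ k) - + 2 * B (ℕ.suc (toℕ k)) + B (ℕ.suc (ℕ.suc (toℕ k))) →
      edgeFlow a (u , F fzero) (F (fsuc k)) + edgeFlow a (F fzero , F (fsuc fzero)) (F (fsuc k))
        + (∑ (loopPath u (ℕ.suc m) (F ∘ fsuc)) (λ e → edgeFlow a e (F (fsuc k)))
           - edgeFlow a (u , F (fsuc fzero)) (F (fsuc k)))
        ≡ A (ℕ.suc (toℕ k)) - + 2 * A (ℕ.suc (ℕ.suc (toℕ k))) + A (ℕ.suc (ℕ.suc (ℕ.suc (toℕ k))))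
    extend fzero F≡Fk u≢Fk ih rewrite ih | u≢Fk | F≡Fk fzero | F≡Fk (fsuc fzero) =
      second-vertex (a u) (a (F fzero)) (a (F (fsuc fzero))) (A′ 1)
      where second-vertex : ∀ x y z v → (y - x) * (+ 0 - + 0) + (z - y) * (+ 0 - + 1)
                                        + (x - + 2 * z + v - (z - x) * (+ 0 - + 1)) ≡ y - + 2 * z + v
            second-vertex = solve-∀
    extend (fsuc k′) F≡Fk u≢Fk ih rewrite ih | u≢Fk | F≡Fk fzero | F≡Fk (fsuc fzero) =
      later-vertex (a u) (a (F fzero)) (a (F (fsuc fzero)))
                   (A′ (toℕ k′)) (A′ (ℕ.suc (toℕ k′))) (A′ (ℕ.suc (ℕ.suc (toℕ k′))))
      where later-vertex : ∀ x y z p q r → (y - x) * (+ 0 - + 0) + (z - y) * (+ 0 - + 0)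
                                           + (p - + 2 * q + r - (z - x) * (+ 0 - + 0)) ≡ p - + 2 * q + r
            later-vertex = solve-∀

infixl 7 _mod⁺_ _div⁺_

_mod⁺_ : ℤ → ℕ → ℕ
a mod⁺ n = a ℤ.% + ℕ.suc n

_div⁺_ : ℤ → ℕ → ℤ
a div⁺ n = a ℤ./ + ℕ.suc n

mod⁺-spec : ∀ a n → a ≡ + (a mod⁺ n) + (a div⁺ n) * + ℕ.suc n
mod⁺-spec a n = a≡a%n+[a/n]*n a (+ ℕ.suc n)

mod⁺-< : ∀ a n → a mod⁺ n ℕ.< ℕ.suc n
mod⁺-< a n = n%d<d a (+ ℕ.suc n)

private
  no-positive-shift : ∀ m r r′ k → r ℕ.< m → + r ≡ + r′ + + ℕ.suc k * + m → ⊥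
  no-positive-shift m r r′ k r<m eq = ℕP.<⇒≱ r<m (begin
      m                       ≤⟨ ℕP.m≤m+n m (k ℕ.* m) ⟩
      ℕ.suc k ℕ.* m           ≤⟨ ℕP.m≤n+m (ℕ.suc k ℕ.* m) r′ ⟩
      r′ ℕ.+ ℕ.suc k ℕ.* m    ≡⟨ ℤP.+-injective (trans (sym eq′) (sym (ℤP.pos-+ r′ _))) ⟨
      r                       ∎)
    where
    open ℕP.≤-Reasoning
    eq′ : + r′ + + (ℕ.suc k ℕ.* m) ≡ + r
    eq′ = trans (cong (_+_ (+ r′)) (ℤP.pos-* (ℕ.suc k) m)) (sym eq)

  remainder-unique : ∀ m r r′ (d : ℤ) → r ℕ.< m → r′ ℕ.< m → + r ≡ + r′ + d * + m → r ≡ r′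
  remainder-unique m r r′ (+ ℕ.zero) _ _ eq =
    ℤP.+-injective (trans eq (trans (cong (_+_ (+ r′)) (ℤP.*-zeroˡ (+ m))) (ℤP.+-identityʳ (+ r′))))
  remainder-unique m r r′ (+ ℕ.suc k) r<m _ eq = ⊥-elim (no-positive-shift m r r′ k r<m eq)
  remainder-unique m r r′ -[1+ k ] _ r′<m eq =
    ⊥-elim (no-positive-shift m r′ r k r′<m (flip (+ r) (+ r′) -[1+ k ] (+ m) eq))
    where flip : ∀ r r′ d m → r ≡ r′ + d * m → r′ ≡ r + (- d) * m
          flip r r′ d m eq = trans (cancel r′ d m) (cong (λ t → t + (- d) * m) (sym eq))
            where cancel : ∀ r′ d m → r′ ≡ r′ + d * m + (- d) * m
                  cancel = solve-∀

mod⁺-unique : ∀ a n r q → r ℕ.< ℕ.suc n → a ≡ + r + q * + ℕ.suc n → a mod⁺ n ≡ r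
mod⁺-unique a n r q r<sn eq =
  remainder-unique (ℕ.suc n) (a mod⁺ n) r (q - a div⁺ n) (mod⁺-< a n) r<sn
                   (compare (+ (a mod⁺ n)) (+ r) q (a div⁺ n) (+ ℕ.suc n) a (mod⁺-spec a n) eq)
  where compare : ∀ x y q p m a → a ≡ x + p * m → a ≡ y + q * m → x ≡ y + (q - p) * m
        compare x y q p m a eq₁ eq₂ =
          trans (add-sub x p m) (trans (cong (_- p * m) (trans (sym eq₁) eq₂)) (collect y q p m))
          where add-sub : ∀ x p m → x ≡ x + p * m - p * m
                add-sub = solve-∀
                collect : ∀ y q p m → y + q * m - p * m ≡ y + (q - p) * m
                collect = solve-∀

mod⁺-shift : ∀ a b n t → b ≡ a + t * + ℕ.suc n → b mod⁺ n ≡ a mod⁺ n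
mod⁺-shift a b n t eq = mod⁺-unique b n (a mod⁺ n) (a div⁺ n + t) (mod⁺-< a n)
  (trans eq (trans (cong (_+ t * + ℕ.suc n) (mod⁺-spec a n)) (collect (+ (a mod⁺ n)) (a div⁺ n) t (+ ℕ.suc n))))
  where collect : ∀ x p t m → x + p * m + t * m ≡ x + (p + t) * m
        collect = solve-∀

mod⁺-zero : ∀ n → + 0 mod⁺ n ≡ 0
mod⁺-zero n = mod⁺-unique (+ 0) n 0 (+ 0) (ℕ.s≤s ℕ.z≤n) refl

mod⁺-minus-one : ∀ n → - + 1 mod⁺ n ≡ n
mod⁺-minus-one n = mod⁺-unique (- + 1) n n (- + 1) ℕP.≤-refl (wrap (+ n))
  where wrap : ∀ x → - + 1 ≡ x + - + 1 * (+ 1 + x)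
        wrap = solve-∀

mod⁺-neg-zero : ∀ a n → a mod⁺ n ≡ 0 → (- a) mod⁺ n ≡ 0
mod⁺-neg-zero a n a≡0 = mod⁺-unique (- a) n 0 (- (a div⁺ n)) (ℕ.s≤s ℕ.z≤n)
  (trans (cong -_ (trans (mod⁺-spec a n) (cong (λ r → + r + a div⁺ n * + ℕ.suc n) a≡0)))
         (negate (a div⁺ n) (+ ℕ.suc n)))
  where negate : ∀ q m → - (+ 0 + q * m) ≡ + 0 + (- q) * m
        negate = solve-∀

positive : ℕ → Bool
positive ℕ.zero    = false
positive (ℕ.suc _) = true

nonzero : ℕ → ℤ
nonzero r = ⟦ positive r ⟧

positive-mod⁺-neg : ∀ a n → positive ((- a) mod⁺ n) ≡ positive (a mod⁺ n)
positive-mod⁺-neg a n with a mod⁺ n in a≡r | (- a) mod⁺ n in -a≡r′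
... | ℕ.zero  | ℕ.zero  = refl
... | ℕ.suc _ | ℕ.suc _ = refl
... | ℕ.zero  | ℕ.suc _ with () ← trans (sym (mod⁺-neg-zero a n a≡r)) -a≡r′
... | ℕ.suc _ | ℕ.zero  with () ← trans (sym (mod⁺-neg-zero (- a) n -a≡r′))
                                        (trans (cong (_mod⁺ n) (ℤP.neg-involutive a)) a≡r)

-- G₀: the base graph with its loops deleted, on which the pushed-forward linear
-- systems live.
loopless : (N : ℕ) → List (Fin N × Fin N) → Graph
loopless N links = record { V = Fin N ; _≟_ = _≟ᶠ_ ; verts = allFin N ; edges = links }

loopBases : {N c : ℕ} → (Fin c → Fin N) → (Fin c → Bool) → Fin N → ℤ
loopBases {c = c} loops s w = ∑ (allFin c) (λ i → δᶠ (loops i) w * ⟦ s i ⟧)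

-- No
-- subdivision occurs in it.
BaseRankAtLeast : (N : ℕ) → List (Fin N × Fin N) → {c : ℕ} → (Fin c → Fin N) → (Fin N → ℤ) → ℕ → Set
BaseRankAtLeast N links loops D k =
  ∀ (E₀ : Fin N → ℤ) s → (∀ w → + 0 ≤ᶻ E₀ w - loopBases loops s w) → ∑ (allFin N) E₀ ≡ + k →
  Laplacian.HasEffective (loopless N links) (λ w → D w - E₀ w - loopBases loops s w)

-- The subdivided graph H = G^(ns)

module Subdivision (N : ℕ) (links : List (Fin N × Fin N)) {c : ℕ} (loops : Fin c → Fin N)
                   (ns : Fin c → ℕ) where

  H : Graph
  H = subdivide N links loops ns

  open Laplacian H public
  module G₀ = Laplacian (loopless N links)

  VH : Set
  VH = SubV N c ns

  old : Fin N → VH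
  old = inj₁

  new : (i : Fin c) → Fin (ns i) → VH
  new i j = inj₂ (i , j)

  δ-old : ∀ p w → δ (old p) (old w) ≡ δᶠ p w
  δ-old = δ-injective _≟ᶠ_ (Graph._≟_ H) old SumP.inj₁-injective

  -- (Deltas between an old and a new vertex reduce to + 0 by computation.)

  δ-new : ∀ i j k → δ (new i j) (new i k) ≡ δᶠ j k
  δ-new i = δ-injective _≟ᶠ_ (Graph._≟_ H) (new i) (λ { refl → refl })

  δ-new-≢ : ∀ {i i′} j k → i ≢ i′ → δ (new i j) (new i′ k) ≡ + 0
  δ-new-≢ j k i≢i′ = δ-≢ (λ { refl → i≢i′ refl })

  ∑-vertices : (f : VH → ℤ) →
    ∑ (Graph.verts H) f ≡ ∑ (allFin N) (f ∘ old) + ∑ (allFin c) (λ i → ∑ (allFin (ns i)) (f ∘ new i))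
  ∑-vertices f =
    trans (∑-++ (map old (allFin N)) _ f)
          (cong₂ _+_ (∑-map old (allFin N) f)
                     (trans (∑-concatMap (λ i → map (new i) (allFin (ns i))) (allFin c) f)
                            (∑-cong (allFin c) (λ i → ∑-map (new i) (allFin (ns i)) f))))

  sifting : Sifting
  sifting g (inj₁ w) = begin
      ∑ (Graph.verts H) (λ x → δ (old w) x * g x)
    ≡⟨ ∑-vertices (λ x → δ (old w) x * g x) ⟩
      ∑ (allFin N) (λ p → δ (old w) (old p) * g (old p))
        + ∑ (allFin c) (λ i → ∑ (allFin (ns i)) (λ j → + 0 * g (new i j)))
    ≡⟨ cong₂ _+_ (trans (∑-cong (allFin N) (λ p → cong (_* g (old p)) (δ-old w p)))
                        (sift-allFin N (g ∘ old) w))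
                 (∑-zero (allFin c) _ (λ i → ∑-zero (allFin (ns i)) _ (λ j → ℤP.*-zeroˡ (g (new i j))))) ⟩
      g (old w) + + 0
    ≡⟨ ℤP.+-identityʳ (g (old w)) ⟩
      g (old w) ∎
    where open ≡-Reasoning
  sifting g (inj₂ (i , k)) = begin
      ∑ (Graph.verts H) (λ x → δ (new i k) x * g x)
    ≡⟨ ∑-vertices (λ x → δ (new i k) x * g x) ⟩
      ∑ (allFin N) (λ p → + 0 * g (old p))
        + ∑ (allFin c) (λ i′ → ∑ (allFin (ns i′)) (λ j → δ (new i k) (new i′ j) * g (new i′ j)))
    ≡⟨ cong₂ _+_ (∑-zero (allFin N) _ (λ p → ℤP.*-zeroˡ (g (old p))))
                 (trans (∑-cong (allFin c) chain) (sift-allFin c (λ _ → g (new i k)) i)) ⟩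
      + 0 + g (new i k)
    ≡⟨ ℤP.+-identityˡ (g (new i k)) ⟩
      g (new i k) ∎
    where
    open ≡-Reasoning
    chain : ∀ i′ → ∑ (allFin (ns i′)) (λ j → δ (new i k) (new i′ j) * g (new i′ j)) ≡ δᶠ i i′ * g (new i k)
    chain i′ with ≡⊎≢ _≟ᶠ_ i i′
    ... | inj₁ refl = trans (∑-cong (allFin (ns i)) (λ j → cong (_* g (new i j)) (δ-new i k j)))
                           (trans (sift-allFin (ns i) (g ∘ new i) k)
                                  (sym (trans (cong (_* g (new i k)) (δᶠ-refl i)) (ℤP.*-identityˡ (g (new i k))))))
    ... | inj₂ i≢i′ = trans (∑-zero (allFin (ns i′)) _
                            (λ j → trans (cong (_* g (new i′ j)) (δ-new-≢ k j i≢i′)) (ℤP.*-zeroˡ (g (new i′ j)))))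
                          (sym (trans (cong (_* g (new i k)) (δᶠ-≢ i≢i′)) (ℤP.*-zeroˡ (g (new i k)))))

  walk : Fin c → List (VH × VH)
  walk i = loopPath (old (loops i)) (ns i) (new i)

  ∑-edges : (f : VH × VH → ℤ) →
    ∑ (Graph.edges H) f ≡ ∑ links (λ e → f (old (proj₁ e) , old (proj₂ e))) + ∑ (allFin c) (λ i → ∑ (walk i) f)
  ∑-edges f = trans (∑-++ (map (λ e → (old (proj₁ e) , old (proj₂ e))) links) _ f)
                    (cong₂ _+_ (∑-map (λ e → (old (proj₁ e) , old (proj₂ e))) links f)
                               (∑-concatMap walk (allFin c) f))

  cycle : (VH → ℤ) → Fin c → ℕ → ℤ
  cycle a i = around (ns i) (a ∘ new i) (a (old (loops i)))

  baseTerm : (VH → ℤ) → Fin c → ℤ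
  baseTerm a i = cycle a i 1 + cycle a i (ns i) - + 2 * cycle a i 0

  Lap-old : ∀ a w → Lap a (old w) ≡ G₀.Lap (a ∘ old) w + ∑ (allFin c) (λ i → δᶠ (loops i) w * baseTerm a i)
  Lap-old a w = trans (∑-edges (λ e → edgeFlow a e (old w)))
                      (cong₂ _+_ (∑-cong links link-flow) (∑-cong (allFin c) loop-flow))
    where
    link-flow : ∀ e → edgeFlow a (old (proj₁ e) , old (proj₂ e)) (old w) ≡ G₀.edgeFlow (a ∘ old) e w
    link-flow (p , q) = cong₂ (λ x y → (a (old q) - a (old p)) * (x - y)) (δ-old p w) (δ-old q w)
    loop-flow : ∀ i → ∑ (walk i) (λ e → edgeFlow a e (old w)) ≡ δᶠ (loops i) w * baseTerm a i
    loop-flow i with ≡⊎≢ _≟ᶠ_ (loops i) w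
    ... | inj₁ refl = trans (loopFlow-base (ns i) (new i) (old w) a (λ j → refl) (δ-refl (old w)))
                            (sym (trans (cong (_* baseTerm a i) (δᶠ-refl w)) (ℤP.*-identityˡ (baseTerm a i))))
    ... | inj₂ base≢w = trans (loopFlow-away (ns i) (new i) (old (loops i)) a (old w)
                                 (trans (δ-old (loops i) w) (δᶠ-≢ base≢w)) (λ j → refl))
                              (sym (trans (cong (_* baseTerm a i) (δᶠ-≢ base≢w)) (ℤP.*-zeroˡ (baseTerm a i))))

  Lap-new : ∀ a i k → Lap a (new i k)
    ≡ cycle a i (toℕ k) - + 2 * cycle a i (ℕ.suc (toℕ k)) + cycle a i (ℕ.suc (ℕ.suc (toℕ k)))
  Lap-new a i k = trans (∑-edges (λ e → edgeFlow a e (new i k)))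
    (trans (cong₂ _+_ (∑-zero links _ (λ e → flow-away a (old (proj₁ e)) (old (proj₂ e)) (new i k) refl refl))
                      (trans (∑-cong (allFin c) loop-flow) (sift-allFin c (λ _ → second) i)))
           (ℤP.+-identityˡ second))
    where
    second : ℤ
    second = cycle a i (toℕ k) - + 2 * cycle a i (ℕ.suc (toℕ k)) + cycle a i (ℕ.suc (ℕ.suc (toℕ k)))
    loop-flow : ∀ i′ → ∑ (walk i′) (λ e → edgeFlow a e (new i k)) ≡ δᶠ i i′ * second
    loop-flow i′ with ≡⊎≢ _≟ᶠ_ i i′
    ... | inj₁ refl = trans (loopFlow-inner (ns i) (new i) (old (loops i)) a k (λ j → δ-new i j k) refl)
                            (sym (trans (cong (_* second) (δᶠ-refl i)) (ℤP.*-identityˡ second)))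
    ... | inj₂ i≢i′ = trans (loopFlow-away (ns i′) (new i′) (old (loops i′)) a (new i k) refl
                               (λ j → δ-new-≢ j k (≢-sym i≢i′)))
                            (sym (trans (cong (_* second) (δᶠ-≢ i≢i′)) (ℤP.*-zeroˡ second)))

  -- Invariants of divisors on H

  chainDeg : (VH → ℤ) → Fin c → ℤ
  chainDeg X i = ∑ (allFin (ns i)) (X ∘ new i)

  π : (VH → ℤ) → Fin N → ℤ
  π X w = X (old w) + ∑ (allFin c) (λ i → δᶠ (loops i) w * chainDeg X i)

  moment : (VH → ℤ) → Fin c → ℤ
  moment X i = ∑ (allFin (ns i)) (λ j → + ℕ.suc (toℕ j) * X (new i j))

  cycle-end : ∀ a i → cycle a i (ℕ.suc (ns i)) ≡ cycle a i 0
  cycle-end a i = along-end (ns i) (a ∘ new i) (a (old (loops i)))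

  chainDeg-Lap : ∀ a i → chainDeg (Lap a) i ≡ (cycle a i 0 - cycle a i (ns i)) - (cycle a i 1 - cycle a i 0)
  chainDeg-Lap a i = begin
      ∑ (allFin (ns i)) (λ k → Lap a (new i k))
    ≡⟨ ∑-cong (allFin (ns i)) (Lap-new a i) ⟩
      ∑ (allFin (ns i)) (second ∘ toℕ)
    ≡⟨ ∑-toℕ (ns i) second ⟩
      ∑< (ns i) second
    ≡⟨ ∑<-second-difference (ns i) (cycle a i) ⟩
      (cycle a i (ℕ.suc (ns i)) - cycle a i (ns i)) - (cycle a i 1 - cycle a i 0)
    ≡⟨ cong (λ x → (x - cycle a i (ns i)) - (cycle a i 1 - cycle a i 0)) (cycle-end a i) ⟩
      (cycle a i 0 - cycle a i (ns i)) - (cycle a i 1 - cycle a i 0) ∎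
    where
    open ≡-Reasoning
    second : ℕ → ℤ
    second t = cycle a i t - + 2 * cycle a i (ℕ.suc t) + cycle a i (ℕ.suc (ℕ.suc t))

  π-Lap : ∀ a w → π (Lap a) w ≡ G₀.Lap (a ∘ old) w
  π-Lap a w = begin
      Lap a (old w) + ∑ (allFin c) (λ i → δᶠ (loops i) w * chainDeg (Lap a) i)
    ≡⟨ cong₂ _+_ (Lap-old a w) (∑-cong (allFin c) (λ i → cong (_*_ (δᶠ (loops i) w)) (chainDeg-Lap a i))) ⟩
      G₀.Lap (a ∘ old) w + ∑ (allFin c) (λ i → δᶠ (loops i) w * baseTerm a i)
        + ∑ (allFin c) (λ i → δᶠ (loops i) w * chainTerm i)
    ≡⟨ ℤP.+-assoc (G₀.Lap (a ∘ old) w) _ _ ⟩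
      G₀.Lap (a ∘ old) w + (∑ (allFin c) (λ i → δᶠ (loops i) w * baseTerm a i)
                             + ∑ (allFin c) (λ i → δᶠ (loops i) w * chainTerm i))
    ≡⟨ cong (_+_ (G₀.Lap (a ∘ old) w))
            (trans (sym (∑-+ (allFin c) (λ i → δᶠ (loops i) w * baseTerm a i) (λ i → δᶠ (loops i) w * chainTerm i)))
                   (∑-zero (allFin c) _ (λ i → cancel (δᶠ (loops i) w) (cycle a i 0) (cycle a i 1) (cycle a i (ns i))))) ⟩
      G₀.Lap (a ∘ old) w + + 0
    ≡⟨ ℤP.+-identityʳ (G₀.Lap (a ∘ old) w) ⟩
      G₀.Lap (a ∘ old) w ∎
    where
    open ≡-Reasoning
    chainTerm : Fin c → ℤ
    chainTerm i = (cycle a i 0 - cycle a i (ns i)) - (cycle a i 1 - cycle a i 0)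
    cancel : ∀ d x y z → d * (y + z - + 2 * x) + d * ((x - z) - (y - x)) ≡ + 0
    cancel = solve-∀

  moment-Lap : ∀ a i → moment (Lap a) i ≡ (+ 1 + + ns i) * (cycle a i 0 - cycle a i (ns i))
  moment-Lap a i = begin
      ∑ (allFin (ns i)) (λ k → + ℕ.suc (toℕ k) * Lap a (new i k))
    ≡⟨ ∑-cong (allFin (ns i)) (λ k → cong (_*_ (+ ℕ.suc (toℕ k))) (Lap-new a i k)) ⟩
      ∑ (allFin (ns i)) (weighted ∘ toℕ)
    ≡⟨ ∑-toℕ (ns i) weighted ⟩
      ∑< (ns i) weighted
    ≡⟨ ∑<-weighted-second-difference (ns i) (cycle a i) ⟩
      + ns i * (cycle a i (ℕ.suc (ns i)) - cycle a i (ns i)) - (cycle a i (ns i) - cycle a i 0)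
    ≡⟨ cong (λ x → + ns i * (x - cycle a i (ns i)) - (cycle a i (ns i) - cycle a i 0)) (cycle-end a i) ⟩
      + ns i * (cycle a i 0 - cycle a i (ns i)) - (cycle a i (ns i) - cycle a i 0)
    ≡⟨ collect (+ ns i) (cycle a i 0) (cycle a i (ns i)) ⟩
      (+ 1 + + ns i) * (cycle a i 0 - cycle a i (ns i)) ∎
    where
    open ≡-Reasoning
    weighted : ℕ → ℤ
    weighted t = (+ 1 + + t) * (cycle a i t - + 2 * cycle a i (ℕ.suc t) + cycle a i (ℕ.suc (ℕ.suc t)))
    collect : ∀ n x y → n * (x - y) - (y - x) ≡ (+ 1 + n) * (x - y)
    collect = solve-∀

  -- Positions 0 and n + 1 of a cycle with n new vertices are its base vertex.
  atBase : ℕ → ℕ → ℤ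
  atBase n t = δℕ t 0 + δℕ t (ℕ.suc n)

  atBase-inner : ∀ n κ → κ ℕ.< n → atBase n (ℕ.suc κ) ≡ + 0
  atBase-inner n κ κ<n = trans (ℤP.+-identityˡ (δℕ κ n)) (δℕ-≢ κ n (ℕP.<⇒≢ κ<n))

  -- One chip at position t of the i-th cycle: position k + 1 is the k-th new
  -- vertex, positions 0 and ns i + 1 are the base vertex.
  chip : Fin c → ℕ → VH → ℤ
  chip i t (inj₁ w)        = δᶠ (loops i) w * atBase (ns i) t
  chip i t (inj₂ (i′ , k)) = δᶠ i′ i * δℕ (ℕ.suc (toℕ k)) t

  chip-nonneg : ∀ i t v → + 0 ≤ᶻ chip i t v
  chip-nonneg i t (inj₁ w) =
    *-nonneg (δᶠ-nonneg (loops i) w) (ℤP.+-mono-≤ (δℕ-nonneg t 0) (δℕ-nonneg t (ℕ.suc (ns i))))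
  chip-nonneg i t (inj₂ (i′ , k)) = *-nonneg (δᶠ-nonneg i′ i) (δℕ-nonneg (ℕ.suc (toℕ k)) t)

  cycle-chip : ∀ i κ → κ ℕ.< ns i → ∀ i′ t → cycle (chip i (ℕ.suc κ)) i′ t ≡ δᶠ i′ i * δℕ t (ℕ.suc κ)
  cycle-chip i κ κ<n i′ ℕ.zero =
    trans (cong (_*_ (δᶠ (loops i) (loops i′))) (atBase-inner (ns i) κ κ<n))
          (trans (ℤP.*-zeroʳ (δᶠ (loops i) (loops i′))) (sym (ℤP.*-zeroʳ (δᶠ i′ i))))
  cycle-chip i κ κ<n i′ (ℕ.suc t) with t ℕP.<? ns i′
  ... | yes t<n′ = along-< (ns i′) (λ s → δᶠ i′ i * δℕ s κ) _ t t<n′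
  ... | no  t≮n′ =
    trans (along-≥ (ns i′) (λ s → δᶠ i′ i * δℕ s κ) _ t (ℕP.≮⇒≥ t≮n′))
          (trans (cong (_*_ (δᶠ (loops i) (loops i′))) (atBase-inner (ns i) κ κ<n))
                 (trans (ℤP.*-zeroʳ (δᶠ (loops i) (loops i′))) (sym beyond)))
    where
    beyond : δᶠ i′ i * δℕ t κ ≡ + 0
    beyond with ≡⊎≢ _≟ᶠ_ i′ i
    ... | inj₁ refl = trans (cong (_*_ (δᶠ i′ i)) (δℕ-≢ t κ (λ { refl → t≮n′ κ<n })))
                            (ℤP.*-zeroʳ (δᶠ i′ i))
    ... | inj₂ i′≢i = trans (cong (_* δℕ t κ) (δᶠ-≢ i′≢i)) (ℤP.*-zeroˡ (δℕ t κ))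

  -- The Laplacian of a chip at an inner position is the second difference of
  -- chips: firing that position sends one chip to each of its two neighbours.
  Lap-chip : ∀ i κ → κ ℕ.< ns i → ∀ v →
             Lap (chip i (ℕ.suc κ)) v ≡ chip i κ v - + 2 * chip i (ℕ.suc κ) v + chip i (ℕ.suc (ℕ.suc κ)) v
  Lap-chip i κ κ<n (inj₁ w) = begin
      Lap (chip i (ℕ.suc κ)) (old w)
    ≡⟨ Lap-old (chip i (ℕ.suc κ)) w ⟩
      G₀.Lap (chip i (ℕ.suc κ) ∘ old) w + ∑ (allFin c) (λ i′ → δᶠ (loops i′) w * baseTerm (chip i (ℕ.suc κ)) i′)
    ≡⟨ cong₂ _+_ (G₀.Lap-zero (chip i (ℕ.suc κ) ∘ old) w
                   (λ p → trans (cong (_*_ (δᶠ (loops i) p)) (atBase-inner (ns i) κ κ<n)) (ℤP.*-zeroʳ (δᶠ (loops i) p))))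
                 (∑-cong (allFin c) base-contribution) ⟩
      + 0 + ∑ (allFin c) (λ i′ → δᶠ i i′ * (δᶠ (loops i′) w * (δℕ 0 κ + δℕ (ns i′) (ℕ.suc κ))))
    ≡⟨ trans (ℤP.+-identityˡ _) (sift-allFin c (λ i′ → δᶠ (loops i′) w * (δℕ 0 κ + δℕ (ns i′) (ℕ.suc κ))) i) ⟩
      δᶠ (loops i) w * (δℕ 0 κ + δℕ (ns i) (ℕ.suc κ))
    ≡⟨ cong₂ (λ x y → δᶠ (loops i) w * (x + y)) (δℕ-sym 0 κ) (δℕ-sym (ns i) (ℕ.suc κ)) ⟩
      δᶠ (loops i) w * (δℕ κ 0 + δℕ (ℕ.suc κ) (ns i))
    ≡⟨ spread (δᶠ (loops i) w) (δℕ κ 0) (δℕ (ℕ.suc κ) (ns i)) ⟩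
      δᶠ (loops i) w * (δℕ κ 0 + + 0) - + 2 * (δᶠ (loops i) w * + 0) + δᶠ (loops i) w * (+ 0 + δℕ (ℕ.suc κ) (ns i))
    ≡⟨ cong₂ (λ x y → δᶠ (loops i) w * (δℕ κ 0 + x) - + 2 * (δᶠ (loops i) w * y)
                      + δᶠ (loops i) w * (+ 0 + δℕ (ℕ.suc κ) (ns i)))
             (sym (δℕ-≢ κ (ℕ.suc (ns i)) (ℕP.<⇒≢ (ℕP.<-trans κ<n (ℕP.n<1+n _)))))
             (sym (atBase-inner (ns i) κ κ<n)) ⟩
      chip i κ (old w) - + 2 * chip i (ℕ.suc κ) (old w) + chip i (ℕ.suc (ℕ.suc κ)) (old w) ∎
    where
    open ≡-Reasoning
    base-contribution : ∀ i′ → δᶠ (loops i′) w * baseTerm (chip i (ℕ.suc κ)) i′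
                               ≡ δᶠ i i′ * (δᶠ (loops i′) w * (δℕ 0 κ + δℕ (ns i′) (ℕ.suc κ)))
    base-contribution i′ =
      trans (cong (_*_ (δᶠ (loops i′) w))
                  (cong₂ (λ x y → x - + 2 * y)
                         (cong₂ _+_ (cycle-chip i κ κ<n i′ 1) (cycle-chip i κ κ<n i′ (ns i′)))
                         (cycle-chip i κ κ<n i′ 0)))
            (trans (regroup (δᶠ (loops i′) w) (δᶠ i′ i) (δℕ 0 κ) (δℕ (ns i′) (ℕ.suc κ)))
                   (cong (_* (δᶠ (loops i′) w * (δℕ 0 κ + δℕ (ns i′) (ℕ.suc κ)))) (δᶠ-sym i′ i)))
      where regroup : ∀ d e x y → d * (e * x + e * y - + 2 * (e * + 0)) ≡ e * (d * (x + y))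
            regroup = solve-∀
    spread : ∀ d x y → d * (x + y) ≡ d * (x + + 0) - + 2 * (d * + 0) + d * (+ 0 + y)
    spread = solve-∀
  Lap-chip i κ κ<n (inj₂ (i′ , k)) = begin
      Lap (chip i (ℕ.suc κ)) (new i′ k)
    ≡⟨ Lap-new (chip i (ℕ.suc κ)) i′ k ⟩
      C (toℕ k) - + 2 * C (ℕ.suc (toℕ k)) + C (ℕ.suc (ℕ.suc (toℕ k)))
    ≡⟨ cong₂ _+_ (cong₂ (λ x y → x - + 2 * y) (cycle-chip i κ κ<n i′ (toℕ k)) (cycle-chip i κ κ<n i′ (ℕ.suc (toℕ k))))
                 (cycle-chip i κ κ<n i′ (ℕ.suc (ℕ.suc (toℕ k)))) ⟩
      e * δℕ (toℕ k) (ℕ.suc κ) - + 2 * (e * δℕ (ℕ.suc (toℕ k)) (ℕ.suc κ)) + e * δℕ (ℕ.suc (toℕ k)) κ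
    ≡⟨ reverse (e * δℕ (toℕ k) (ℕ.suc κ)) (e * δℕ (ℕ.suc (toℕ k)) (ℕ.suc κ)) (e * δℕ (ℕ.suc (toℕ k)) κ) ⟩
      chip i κ (new i′ k) - + 2 * chip i (ℕ.suc κ) (new i′ k) + chip i (ℕ.suc (ℕ.suc κ)) (new i′ k) ∎
    where
    open ≡-Reasoning
    C : ℕ → ℤ
    C = cycle (chip i (ℕ.suc κ)) i′
    e : ℤ
    e = δᶠ i′ i
    reverse : ∀ x y z → x - + 2 * y + z ≡ z - + 2 * y + x
    reverse = solve-∀

  chip-wrap : ∀ i v → chip i (ℕ.suc (ns i)) v ≡ chip i 0 v
  chip-wrap i (inj₁ w) = cong (λ x → δᶠ (loops i) w * (+ 0 + x)) (δℕ-refl (ns i))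
  chip-wrap i (inj₂ (i′ , k)) with ≡⊎≢ _≟ᶠ_ i′ i
  ... | inj₁ refl = cong (_*_ (δᶠ i′ i)) (δℕ-≢ (toℕ k) (ns i) (ℕP.<⇒≢ (Data.Fin.Properties.toℕ<n k)))
  ... | inj₂ i′≢i = trans (cong (_* δℕ (ℕ.suc (toℕ k)) (ℕ.suc (ns i))) (δᶠ-≢ i′≢i))
                          (trans (ℤP.*-zeroˡ (δℕ (ℕ.suc (toℕ k)) (ℕ.suc (ns i)))) (sym (ℤP.*-zeroʳ (δᶠ i′ i))))

  step : Fin c → ℕ → VH → ℤ
  step i t v = chip i (ℕ.suc t) v - chip i t v

  step-≈ : ∀ i t → t ℕ.≤ ns i → step i t ≈ step i 0
  step-≈ i ℕ.zero    _    = ≈-refl {step i 0}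
  step-≈ i (ℕ.suc t) t<n = ≈-trans {step i (ℕ.suc t)} {step i t} {step i 0}
    (chip i (ℕ.suc t) , λ v → trans (second-difference (chip i t v) (chip i (ℕ.suc t) v) (chip i (ℕ.suc (ℕ.suc t)) v))
                                    (sym (Lap-chip i t t<n v)))
    (step-≈ i t (ℕP.<⇒≤ t<n))
    where second-difference : ∀ a b c → (c - b) - (b - a) ≡ a - + 2 * b + c
          second-difference = solve-∀

  chip-≈ : ∀ i t → t ℕ.≤ ns i → (λ v → chip i (ℕ.suc t) v - chip i 0 v) ≈ (λ v → (+ 1 + + t) * step i 0 v)
  chip-≈ i ℕ.zero _ = ≈-reflexive (λ v → sym (ℤP.*-identityˡ (step i 0 v)))
  chip-≈ i (ℕ.suc t) t<n =
    ≈-trans {λ v → chip i (ℕ.suc (ℕ.suc t)) v - chip i 0 v} {λ v → step i (ℕ.suc t) v + (chip i (ℕ.suc t) v - chip i 0 v)}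
      (≈-reflexive (λ v → telescope (chip i 0 v) (chip i (ℕ.suc t) v) (chip i (ℕ.suc (ℕ.suc t)) v)))
      (≈-trans {λ v → step i (ℕ.suc t) v + (chip i (ℕ.suc t) v - chip i 0 v)} {λ v → step i 0 v + (+ 1 + + t) * step i 0 v}
        (≈-+ {step i (ℕ.suc t)} {step i 0} (step-≈ i (ℕ.suc t) t<n) (chip-≈ i t (ℕP.<⇒≤ t<n)))
        (≈-reflexive (λ v → collect (+ t) (step i 0 v))))
    where telescope : ∀ a b c → c - a ≡ (c - b) + (b - a)
          telescope = solve-∀
          collect : ∀ t x → x + (+ 1 + t) * x ≡ (+ 1 + (+ 1 + t)) * x
          collect = solve-∀

  chip-≈-start : ∀ i κ → κ ℕ.< ns i → chip i (ℕ.suc κ) ≈ (λ v → chip i 0 v + (+ 1 + + κ) * step i 0 v)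
  chip-≈-start i κ κ<n =
    ≈-trans {chip i (ℕ.suc κ)} {λ v → chip i 0 v + (chip i (ℕ.suc κ) v - chip i 0 v)}
      (≈-reflexive (λ v → add-sub (chip i 0 v) (chip i (ℕ.suc κ) v)))
      (≈-+ {chip i 0} {chip i 0} (≈-refl {chip i 0}) (chip-≈ i κ (ℕP.<⇒≤ κ<n)))
    where add-sub : ∀ a b → b ≡ a + (b - a)
          add-sub = solve-∀

  cycle-closes : ∀ i → (λ v → (+ 1 + + ns i) * step i 0 v) ≈ (λ _ → + 0)
  cycle-closes i =
    ≈-trans {λ v → (+ 1 + + ns i) * step i 0 v} {λ v → chip i (ℕ.suc (ns i)) v - chip i 0 v} {λ _ → + 0}
      (≈-sym {λ v → chip i (ℕ.suc (ns i)) v - chip i 0 v} (chip-≈ i (ns i) ℕP.≤-refl))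
      (≈-reflexive (λ v → trans (cong (_- chip i 0 v) (chip-wrap i v)) (ℤP.+-inverseʳ (chip i 0 v))))

  steps-≈ : ∀ i (A q : ℤ) (r : ℕ) → A ≡ + r + q * (+ 1 + + ns i) → r ℕ.≤ ns i →
            (λ v → A * step i 0 v) ≈ (λ v → chip i r v - chip i 0 v)
  steps-≈ i A q r A≡r+qn r≤n =
    ≈-trans {λ v → A * step i 0 v} {λ v → + r * step i 0 v + q * ((+ 1 + + ns i) * step i 0 v)}
      (≈-reflexive (λ v → trans (cong (_* step i 0 v) A≡r+qn) (distrib (+ r) q (+ 1 + + ns i) (step i 0 v))))
      (≈-trans {λ v → + r * step i 0 v + q * ((+ 1 + + ns i) * step i 0 v)} {λ v → + r * step i 0 v + q * + 0}
        (≈-+ {λ v → + r * step i 0 v} {λ v → + r * step i 0 v} (≈-refl {λ v → + r * step i 0 v})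
             (≈-* q {λ v → (+ 1 + + ns i) * step i 0 v} {λ _ → + 0} (cycle-closes i)))
        (residue r r≤n))
    where
    distrib : ∀ r q m s → (r + q * m) * s ≡ r * s + q * (m * s)
    distrib = solve-∀
    residue : ∀ r → r ℕ.≤ ns i → (λ v → + r * step i 0 v + q * + 0) ≈ (λ v → chip i r v - chip i 0 v)
    residue ℕ.zero _ = ≈-reflexive (λ v → trans (vanish q (step i 0 v)) (sym (ℤP.+-inverseʳ (chip i 0 v))))
      where vanish : ∀ q s → + 0 * s + q * + 0 ≡ + 0
            vanish = solve-∀
    residue (ℕ.suc κ) κ<n =
      ≈-trans {λ v → + ℕ.suc κ * step i 0 v + q * + 0} {λ v → (+ 1 + + κ) * step i 0 v}
        (≈-reflexive (λ v → drop (+ κ) q (step i 0 v)))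
        (≈-sym {λ v → chip i (ℕ.suc κ) v - chip i 0 v} (chip-≈ i κ (ℕP.<⇒≤ κ<n)))
      where drop : ∀ k q s → (+ 1 + k) * s + q * + 0 ≡ (+ 1 + k) * s
            drop = solve-∀

  -- Normal form

  σ : (Fin N → ℤ) → VH → ℤ
  σ = σ* {N} {c} {ns}

  decompose : ∀ X v → X v ≡ σ (X ∘ old) v
                            + ∑ (allFin c) (λ i → ∑ (allFin (ns i)) (λ k → X (new i k) * chip i (ℕ.suc (toℕ k)) v))
  decompose X (inj₁ w) = sym (trans (cong (_+_ (X (old w))) (∑-zero (allFin c) _ inner-zero))
                                    (ℤP.+-identityʳ (X (old w))))
    where
    inner-zero : ∀ i → ∑ (allFin (ns i)) (λ k → X (new i k) * chip i (ℕ.suc (toℕ k)) (old w)) ≡ + 0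
    inner-zero i = ∑-zero (allFin (ns i)) _ (λ k →
      trans (cong (λ x → X (new i k) * (δᶠ (loops i) w * x))
                  (atBase-inner (ns i) (toℕ k) (Data.Fin.Properties.toℕ<n k)))
            (vanish (X (new i k)) (δᶠ (loops i) w)))
      where vanish : ∀ x d → x * (d * + 0) ≡ + 0
            vanish = solve-∀
  decompose X (inj₂ (i′ , k′)) = sym (trans (ℤP.+-identityˡ _)
    (trans (∑-cong (allFin c) on-chain) (sift-allFin c (λ _ → X (new i′ k′)) i′)))
    where
    on-chain : ∀ i → ∑ (allFin (ns i)) (λ k → X (new i k) * (δᶠ i′ i * δℕ (ℕ.suc (toℕ k′)) (ℕ.suc (toℕ k))))
                     ≡ δᶠ i′ i * X (new i′ k′)
    on-chain i with ≡⊎≢ _≟ᶠ_ i′ i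
    ... | inj₁ refl =
      trans (∑-cong (allFin (ns i′)) (λ k →
               trans (cong (_*_ (X (new i′ k))) (trans (cong₂ _*_ (δᶠ-refl i′) (δℕ-toℕ k′ k)) (ℤP.*-identityˡ (δᶠ k′ k))))
                     (ℤP.*-comm (X (new i′ k)) (δᶠ k′ k))))
            (trans (sift-allFin (ns i′) (X ∘ new i′) k′)
                   (sym (trans (cong (_* X (new i′ k′)) (δᶠ-refl i′)) (ℤP.*-identityˡ (X (new i′ k′))))))
    ... | inj₂ i′≢i =
      trans (∑-zero (allFin (ns i)) _ (λ k →
               trans (cong (λ x → X (new i k) * (x * δℕ (ℕ.suc (toℕ k′)) (ℕ.suc (toℕ k)))) (δᶠ-≢ i′≢i))
                     (vanish (X (new i k)) (δℕ (ℕ.suc (toℕ k′)) (ℕ.suc (toℕ k))))))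
            (sym (trans (cong (_* X (new i′ k′)) (δᶠ-≢ i′≢i)) (ℤP.*-zeroˡ (X (new i′ k′)))))
      where vanish : ∀ x e → x * (+ 0 * e) ≡ + 0
            vanish = solve-∀

  σ-π : ∀ X v → σ (X ∘ old) v + ∑ (allFin c) (λ i → chainDeg X i * chip i 0 v) ≡ σ (π X) v
  σ-π X (inj₁ w) = cong (_+_ (X (old w))) (∑-cong (allFin c) (λ i → swap (chainDeg X i) (δᶠ (loops i) w)))
    where swap : ∀ d e → d * (e * + 1) ≡ e * d
          swap = solve-∀
  σ-π X (inj₂ (i′ , k)) = trans (ℤP.+-identityˡ _) (∑-zero (allFin c) _ (λ i → vanish (chainDeg X i) (δᶠ i′ i)))
    where vanish : ∀ d e → d * (e * + 0) ≡ + 0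
          vanish = solve-∀

  normal-form : ∀ X → X ≈ (λ v → σ (π X) v + ∑ (allFin c) (λ i → moment X i * step i 0 v))
  normal-form X =
    ≈-trans {X} {decomposed} (≈-reflexive (decompose X))
      (≈-trans {decomposed} {expanded}
        (≈-+ {σ (X ∘ old)} {σ (X ∘ old)} (≈-refl {σ (X ∘ old)})
          (≈-∑ (allFin c) (λ i v → ∑ (allFin (ns i)) (λ k → X (new i k) * chip i (ℕ.suc (toℕ k)) v))
                          (λ i v → ∑ (allFin (ns i)) (λ k → X (new i k) * expand i k v))
            (λ i → ≈-∑ (allFin (ns i)) (λ k v → X (new i k) * chip i (ℕ.suc (toℕ k)) v)
                                        (λ k v → X (new i k) * expand i k v)
              (λ k → ≈-* (X (new i k)) {chip i (ℕ.suc (toℕ k))} {expand i k}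
                          (chip-≈-start i (toℕ k) (Data.Fin.Properties.toℕ<n k))))))
        (≈-reflexive collect))
    where
    expand : ∀ i → Fin (ns i) → VH → ℤ
    expand i k v = chip i 0 v + (+ 1 + + toℕ k) * step i 0 v
    decomposed expanded : VH → ℤ
    decomposed v = σ (X ∘ old) v + ∑ (allFin c) (λ i → ∑ (allFin (ns i)) (λ k → X (new i k) * chip i (ℕ.suc (toℕ k)) v))
    expanded v = σ (X ∘ old) v + ∑ (allFin c) (λ i → ∑ (allFin (ns i)) (λ k → X (new i k) * expand i k v))
    on-chain : ∀ v i → ∑ (allFin (ns i)) (λ k → X (new i k) * expand i k v)
                       ≡ chainDeg X i * chip i 0 v + moment X i * step i 0 v
    on-chain v i =
      trans (∑-cong (allFin (ns i)) (λ k → distrib (X (new i k)) (chip i 0 v) (+ toℕ k) (step i 0 v)))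
            (trans (∑-+ (allFin (ns i)) (λ k → X (new i k) * chip i 0 v)
                                        (λ k → (+ 1 + + toℕ k) * X (new i k) * step i 0 v))
                   (cong₂ _+_ (∑-*ʳ (allFin (ns i)) (chip i 0 v) (X ∘ new i))
                              (∑-*ʳ (allFin (ns i)) (step i 0 v) (λ k → + ℕ.suc (toℕ k) * X (new i k)))))
      where distrib : ∀ x p t s → x * (p + (+ 1 + t) * s) ≡ x * p + ((+ 1 + t) * x) * s
            distrib = solve-∀
    collect : ∀ v → expanded v ≡ σ (π X) v + ∑ (allFin c) (λ i → moment X i * step i 0 v)
    collect v = begin
        σ (X ∘ old) v + ∑ (allFin c) (λ i → ∑ (allFin (ns i)) (λ k → X (new i k) * expand i k v))
      ≡⟨ cong (_+_ (σ (X ∘ old) v))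
              (trans (∑-cong (allFin c) (on-chain v))
                     (∑-+ (allFin c) (λ i → chainDeg X i * chip i 0 v) (λ i → moment X i * step i 0 v))) ⟩
        σ (X ∘ old) v + (∑ (allFin c) (λ i → chainDeg X i * chip i 0 v) + ∑ (allFin c) (λ i → moment X i * step i 0 v))
      ≡⟨ sym (ℤP.+-assoc (σ (X ∘ old) v) _ _) ⟩
        σ (X ∘ old) v + ∑ (allFin c) (λ i → chainDeg X i * chip i 0 v) + ∑ (allFin c) (λ i → moment X i * step i 0 v)
      ≡⟨ cong (_+ ∑ (allFin c) (λ i → moment X i * step i 0 v)) (σ-π X v) ⟩
        σ (π X) v + ∑ (allFin c) (λ i → moment X i * step i 0 v) ∎
      where open ≡-Reasoning

  residue : (VH → ℤ) → Fin c → ℕ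
  residue X i = moment X i mod⁺ ns i

  reduced-normal-form : ∀ X → X ≈ (λ v → σ (π X) v + ∑ (allFin c) (λ i → chip i (residue X i) v - chip i 0 v))
  reduced-normal-form X = ≈-trans {X} (normal-form X)
    (≈-+ {σ (π X)} {σ (π X)} (≈-refl {σ (π X)})
      (≈-∑ (allFin c) (λ i v → moment X i * step i 0 v) (λ i v → chip i (residue X i) v - chip i 0 v)
        (λ i → steps-≈ i (moment X i) (moment X i div⁺ ns i) (residue X i)
                       (mod⁺-spec (moment X i) (ns i)) (ℕP.≤-pred (mod⁺-< (moment X i) (ns i))))))

  marks : (VH → ℤ) → Fin N → ℤ
  marks X = loopBases loops (λ i → positive (residue X i))

  chainDeg-difference : ∀ {X Y Z} → (∀ v → X v - Y v ≡ Z v) → ∀ i → chainDeg X i - chainDeg Y i ≡ chainDeg Z i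
  chainDeg-difference {X} {Y} eq i =
    trans (sym (∑-- (allFin (ns i)) (X ∘ new i) (Y ∘ new i))) (∑-cong (allFin (ns i)) (eq ∘ new i))

  π-difference : ∀ {X Y Z} → (∀ v → X v - Y v ≡ Z v) → ∀ w → π X w - π Y w ≡ π Z w
  π-difference {X} {Y} {Z} eq w = begin
      X (old w) + ∑ (allFin c) (λ i → δᶠ (loops i) w * chainDeg X i)
        - (Y (old w) + ∑ (allFin c) (λ i → δᶠ (loops i) w * chainDeg Y i))
    ≡⟨ interchange (X (old w)) (Y (old w)) _ _ ⟩
      X (old w) - Y (old w)
        + (∑ (allFin c) (λ i → δᶠ (loops i) w * chainDeg X i) - ∑ (allFin c) (λ i → δᶠ (loops i) w * chainDeg Y i))
    ≡⟨ cong₂ _+_ (eq (old w))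
             (trans (sym (∑-- (allFin c) (λ i → δᶠ (loops i) w * chainDeg X i) (λ i → δᶠ (loops i) w * chainDeg Y i)))
                    (∑-cong (allFin c) (λ i → trans (sym (factor (δᶠ (loops i) w) (chainDeg X i) (chainDeg Y i)))
                                                    (cong (_*_ (δᶠ (loops i) w)) (chainDeg-difference {X} {Y} eq i))))) ⟩
      π Z w ∎
    where
    open ≡-Reasoning
    interchange : ∀ a b c d → a + c - (b + d) ≡ a - b + (c - d)
    interchange = solve-∀
    factor : ∀ e x y → e * (x - y) ≡ e * x - e * y
    factor = solve-∀

  moment-difference : ∀ {X Y Z} → (∀ v → X v - Y v ≡ Z v) → ∀ i → moment X i - moment Y i ≡ moment Z i
  moment-difference {X} {Y} eq i =
    trans (sym (∑-- (allFin (ns i)) (λ k → + ℕ.suc (toℕ k) * X (new i k)) (λ k → + ℕ.suc (toℕ k) * Y (new i k))))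
          (∑-cong (allFin (ns i)) (λ k → trans (sym (factor (+ ℕ.suc (toℕ k)) (X (new i k)) (Y (new i k))))
                                               (cong (_*_ (+ ℕ.suc (toℕ k))) (eq (new i k)))))
    where factor : ∀ e x y → e * (x - y) ≡ e * x - e * y
          factor = solve-∀

  π-σ : ∀ D w → π (σ D) w ≡ D w
  π-σ D w = trans (cong (_+_ (D w)) (∑-zero (allFin c) _ (λ i → trans (cong (_*_ (δᶠ (loops i) w))
                                                                              (∑-zero (allFin (ns i)) _ (λ _ → refl)))
                                                                       (ℤP.*-zeroʳ (δᶠ (loops i) w)))))
                  (ℤP.+-identityʳ (D w))

  moment-σ : ∀ D i → moment (σ D) i ≡ + 0
  moment-σ D i = ∑-zero (allFin (ns i)) _ (λ k → ℤP.*-zeroʳ (+ ℕ.suc (toℕ k)))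

  residue-≈ : ∀ {X Y} → X ≈ Y → ∀ i → residue X i ≡ residue Y i
  residue-≈ {X} {Y} (a , eq) i =
    mod⁺-shift (moment Y i) (moment X i) (ns i) (cycle a i 0 - cycle a i (ns i))
      (trans (add-sub (moment X i) (moment Y i))
             (cong (_+_ (moment Y i)) (trans (moment-difference {X} {Y} eq i)
                                             (trans (moment-Lap a i) (ℤP.*-comm (+ 1 + + ns i) _)))))
    where add-sub : ∀ x y → x ≡ y + (x - y)
          add-sub = solve-∀

  chainDeg-nonneg : ∀ Y → (∀ v → + 0 ≤ᶻ Y v) → ∀ i → + 0 ≤ᶻ chainDeg Y i
  chainDeg-nonneg Y Y≥0 i = ∑-nonneg (allFin (ns i)) (Y ∘ new i) (Y≥0 ∘ new i)

  empty-chain-moment : ∀ Y → (∀ v → + 0 ≤ᶻ Y v) → ∀ i → chainDeg Y i ≡ + 0 → moment Y i ≡ + 0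
  empty-chain-moment Y Y≥0 i empty = ℤP.≤-antisym
    (ℤP.≤-trans moment-bound
                (ℤP.≤-reflexive (trans (cong (_*_ (+ ℕ.suc (ns i))) empty) (ℤP.*-zeroʳ (+ ℕ.suc (ns i))))))
    (∑-nonneg (allFin (ns i)) (λ k → + ℕ.suc (toℕ k) * Y (new i k))
              (λ k → *-nonneg {+ ℕ.suc (toℕ k)} (ℤ.+≤+ ℕ.z≤n) (Y≥0 (new i k))))
    where
    moment-bound : moment Y i ≤ᶻ + ℕ.suc (ns i) * chainDeg Y i
    moment-bound = ℤP.≤-trans
      (∑-mono (allFin (ns i)) _ _ (λ k → *-monoʳ-≤ (Y (new i k)) (ℕ.s≤s (ℕP.<⇒≤ (Data.Fin.Properties.toℕ<n k)))
                                                     (Y≥0 (new i k))))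
      (ℤP.≤-reflexive (∑-*ˡ (allFin (ns i)) (+ ℕ.suc (ns i)) (Y ∘ new i)))

  chainDeg-covers-mark : ∀ Y → (∀ v → + 0 ≤ᶻ Y v) → ∀ i → + 0 ≤ᶻ chainDeg Y i - nonzero (residue Y i)
  chainDeg-covers-mark Y Y≥0 i with residue Y i in residue≡ | chainDeg Y i in chainDeg≡
  ... | ℕ.zero  | d = subst (λ x → + 0 ≤ᶻ x - + 0) chainDeg≡
                            (subst (+ 0 ≤ᶻ_) (sym (ℤP.+-identityʳ (chainDeg Y i))) (chainDeg-nonneg Y Y≥0 i))
  ... | ℕ.suc _ | + ℕ.suc m = ℤ.+≤+ ℕ.z≤n
  ... | ℕ.suc _ | + ℕ.zero
    with () ← trans (sym residue≡)
                    (trans (cong (_mod⁺ ns i) (empty-chain-moment Y Y≥0 i chainDeg≡)) (mod⁺-zero (ns i)))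
  ... | ℕ.suc _ | -[1+ _ ] with () ← ℤP.≤-trans (chainDeg-nonneg Y Y≥0 i) (ℤP.≤-reflexive chainDeg≡)

  π-marks-nonneg : ∀ Y → (∀ v → + 0 ≤ᶻ Y v) → ∀ w → + 0 ≤ᶻ π Y w - marks Y w
  π-marks-nonneg Y Y≥0 w = subst (+ 0 ≤ᶻ_) (sym regroup)
    (ℤP.+-mono-≤ (Y≥0 (old w))
      (∑-nonneg (allFin c) _ (λ i → *-nonneg (δᶠ-nonneg (loops i) w) (chainDeg-covers-mark Y Y≥0 i))))
    where
    regroup : π Y w - marks Y w ≡ Y (old w) + ∑ (allFin c) (λ i → δᶠ (loops i) w * (chainDeg Y i - nonzero (residue Y i)))
    regroup =
      trans (ℤP.+-assoc (Y (old w)) _ _)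
            (cong (_+_ (Y (old w)))
                  (trans (sym (∑-- (allFin c) (λ i → δᶠ (loops i) w * chainDeg Y i)
                                              (λ i → δᶠ (loops i) w * nonzero (residue Y i))))
                         (∑-cong (allFin c) (λ i → sym (factor (δᶠ (loops i) w) (chainDeg Y i) (nonzero (residue Y i)))))))
      where factor : ∀ e x y → e * (x - y) ≡ e * x - e * y
            factor = solve-∀

  effective⇒base : ∀ X → HasEffective X → G₀.HasEffective (λ w → π X w - marks X w)
  effective⇒base X (Y , Y≥0 , a , X-Y≡Lap) =
    (λ w → π Y w - marks Y w) , π-marks-nonneg Y Y≥0 , a ∘ old , λ w → begin
        π X w - marks X w - (π Y w - marks Y w)
      ≡⟨ cong (λ m → π X w - m - (π Y w - marks Y w)) (same-marks w) ⟩
        π X w - marks Y w - (π Y w - marks Y w)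
      ≡⟨ cancel (π X w) (π Y w) (marks Y w) ⟩
        π X w - π Y w
      ≡⟨ π-difference {X} {Y} X-Y≡Lap w ⟩
        π (Lap a) w
      ≡⟨ π-Lap a w ⟩
        G₀.Lap (a ∘ old) w ∎
    where
    open ≡-Reasoning
    cancel : ∀ x y m → x - m - (y - m) ≡ x - y
    cancel = solve-∀
    same-marks : ∀ w → marks X w ≡ marks Y w
    same-marks w = ∑-cong (allFin c) (λ i → cong (λ r → δᶠ (loops i) w * nonzero r)
                                               (residue-≈ {X} {Y} (a , X-Y≡Lap) i))

  extend : (Fin N → ℤ) → VH → ℤ
  extend b (inj₁ p)       = b p
  extend b (inj₂ (i , _)) = b (loops i)

  cycle-extend : ∀ b i t → cycle (extend b) i t ≡ b (loops i)
  cycle-extend b i ℕ.zero    = refl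
  cycle-extend b i (ℕ.suc t) = along-const (ns i) (b (loops i)) t

  Lap-extend : ∀ b v → Lap (extend b) v ≡ σ (G₀.Lap b) v
  Lap-extend b (inj₁ w) =
    trans (Lap-old (extend b) w)
          (trans (cong (_+_ (G₀.Lap b w)) (∑-zero (allFin c) _ (λ i →
                    trans (cong (_*_ (δᶠ (loops i) w))
                                (cong₂ (λ x y → x + y - + 2 * b (loops i))
                                       (cycle-extend b i 1) (cycle-extend b i (ns i))))
                          (flat (δᶠ (loops i) w) (b (loops i))))))
                 (ℤP.+-identityʳ (G₀.Lap b w)))
    where flat : ∀ d x → d * (x + x - + 2 * x) ≡ + 0
          flat = solve-∀
  Lap-extend b (inj₂ (i , k)) =
    trans (Lap-new (extend b) i k)
          (trans (cong₂ _+_ (cong₂ (λ x y → x - + 2 * y) (cycle-extend b i (toℕ k)) (cycle-extend b i (ℕ.suc (toℕ k))))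
                            (cycle-extend b i (ℕ.suc (ℕ.suc (toℕ k)))))
                 (flat (b (loops i))))
    where flat : ∀ x → x - + 2 * x + x ≡ + 0
          flat = solve-∀

  σ-nonneg : ∀ F → (∀ w → + 0 ≤ᶻ F w) → ∀ v → + 0 ≤ᶻ σ F v
  σ-nonneg F F≥0 (inj₁ w) = F≥0 w
  σ-nonneg F F≥0 (inj₂ _) = ℤP.≤-refl

  -- If π X - marks X ∼ F ≥ 0 on G₀, then by the reduced normal form X is
  -- equivalent to σ F plus a chip at position (residue X i) of every cycle
  -- whose residue is nonzero.
  base⇒effective : ∀ X → G₀.HasEffective (λ w → π X w - marks X w) → HasEffective X
  base⇒effective X (F , F≥0 , b , X-F≡Lap) =
    Y , Y≥0 , ≈-trans {X} {R} {Y} (reduced-normal-form X) (extend b , λ v → trans (R-Y v) (sym (Lap-extend b v)))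
    where
    r : Fin c → ℕ
    r = residue X
    R Y : VH → ℤ
    R v = σ (π X) v + ∑ (allFin c) (λ i → chip i (r i) v - chip i 0 v)
    Y v = σ F v + ∑ (allFin c) (λ i → nonzero (r i) * chip i (r i) v)

    Y≥0 : ∀ v → + 0 ≤ᶻ Y v
    Y≥0 v = ℤP.+-mono-≤ (σ-nonneg F F≥0 v)
      (∑-nonneg (allFin c) _ (λ i → *-nonneg (⟦⟧-nonneg (positive (r i))) (chip-nonneg i (r i) v)))

    σπ-split : ∀ v → σ (π X) v ≡ σ F v + ∑ (allFin c) (λ i → nonzero (r i) * chip i 0 v) + σ (G₀.Lap b) v
    σπ-split (inj₁ w) =
      trans (solve-for (π X w) (marks X w) (F w) (G₀.Lap b w) (X-F≡Lap w))
            (cong (λ m → F w + m + G₀.Lap b w) (∑-cong (allFin c) (λ i → swap (δᶠ (loops i) w) (nonzero (r i)))))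
      where
      solve-for : ∀ p m f l → p - m - f ≡ l → p ≡ f + m + l
      solve-for p m f l eq = trans (regroup p m f) (cong (λ x → f + m + x) eq)
        where regroup : ∀ p m f → p ≡ f + m + (p - m - f)
              regroup = solve-∀
      swap : ∀ d z → d * z ≡ z * (d * + 1)
      swap = solve-∀
    σπ-split (inj₂ (i′ , k)) =
      sym (cong (λ x → + 0 + x + + 0) (∑-zero (allFin c) _ (λ i → vanish (nonzero (r i)) (δᶠ i′ i))))
      where vanish : ∀ z d → z * (d * + 0) ≡ + 0
            vanish = solve-∀

    move-mark : ∀ i v → nonzero (r i) * chip i 0 v + (chip i (r i) v - chip i 0 v) ≡ nonzero (r i) * chip i (r i) v
    move-mark i v with r i
    ... | ℕ.zero  = stay (chip i 0 v)
      where stay : ∀ p → + 0 * p + (p - p) ≡ + 0 * p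
            stay = solve-∀
    ... | ℕ.suc t = go (chip i 0 v) (chip i (ℕ.suc t) v)
      where go : ∀ p q → + 1 * p + (q - p) ≡ + 1 * q
            go = solve-∀

    R-Y : ∀ v → R v - Y v ≡ σ (G₀.Lap b) v
    R-Y v = begin
        σ (π X) v + S₁ - (σ F v + S₂)
      ≡⟨ cong (λ x → x + S₁ - (σ F v + S₂)) (σπ-split v) ⟩
        σ F v + M + σ (G₀.Lap b) v + S₁ - (σ F v + S₂)
      ≡⟨ regroup (σ F v) M (σ (G₀.Lap b) v) S₁ S₂ ⟩
        σ (G₀.Lap b) v + (M + S₁ - S₂)
      ≡⟨ cong (λ x → σ (G₀.Lap b) v + (x - S₂))
              (trans (sym (∑-+ (allFin c) (λ i → nonzero (r i) * chip i 0 v) (λ i → chip i (r i) v - chip i 0 v)))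
                     (∑-cong (allFin c) (λ i → move-mark i v))) ⟩
        σ (G₀.Lap b) v + (S₂ - S₂)
      ≡⟨ trans (cong (_+_ (σ (G₀.Lap b) v)) (ℤP.+-inverseʳ S₂)) (ℤP.+-identityʳ _) ⟩
        σ (G₀.Lap b) v ∎
      where
      open ≡-Reasoning
      M S₁ S₂ : ℤ
      M  = ∑ (allFin c) (λ i → nonzero (r i) * chip i 0 v)
      S₁ = ∑ (allFin c) (λ i → chip i (r i) v - chip i 0 v)
      S₂ = ∑ (allFin c) (λ i → nonzero (r i) * chip i (r i) v)
      regroup : ∀ f m l s₁ s₂ → f + m + l + s₁ - (f + s₂) ≡ l + (m + s₁ - s₂)
      regroup = solve-∀

  degree-π : ∀ X → deg H X ≡ ∑ (allFin N) (π X)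
  degree-π X = begin
      ∑ (Graph.verts H) X
    ≡⟨ ∑-vertices X ⟩
      ∑ (allFin N) (X ∘ old) + ∑ (allFin c) (chainDeg X)
    ≡⟨ cong (_+_ (∑ (allFin N) (X ∘ old)))
            (sym (∑-cong (allFin c) (λ i → sift-allFin N (λ _ → chainDeg X i) (loops i)))) ⟩
      ∑ (allFin N) (X ∘ old) + ∑ (allFin c) (λ i → ∑ (allFin N) (λ w → δᶠ (loops i) w * chainDeg X i))
    ≡⟨ cong (_+_ (∑ (allFin N) (X ∘ old))) (∑-swap (allFin c) (allFin N) (λ i w → δᶠ (loops i) w * chainDeg X i)) ⟩
      ∑ (allFin N) (X ∘ old) + ∑ (allFin N) (λ w → ∑ (allFin c) (λ i → δᶠ (loops i) w * chainDeg X i))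
    ≡⟨ sym (∑-+ (allFin N) (X ∘ old) (λ w → ∑ (allFin c) (λ i → δᶠ (loops i) w * chainDeg X i))) ⟩
      ∑ (allFin N) (π X) ∎
    where open ≡-Reasoning

  π-σ-difference : ∀ D E w → π (λ v → σ D v - E v) w ≡ D w - π E w
  π-σ-difference D E w = trans (sym (π-difference {σ D} {E} (λ _ → refl) w)) (cong (_- π E w) (π-σ D w))

  moment-σ-difference : ∀ D E i → moment (λ v → σ D v - E v) i ≡ - moment E i
  moment-σ-difference D E i =
    trans (sym (moment-difference {σ D} {E} (λ _ → refl) i))
          (trans (cong (_- moment E i) (moment-σ D i)) (ℤP.+-identityˡ (- moment E i)))

  marks-σ-difference : ∀ D E w → marks (λ v → σ D v - E v) w ≡ marks E w
  marks-σ-difference D E w = ∑-cong (allFin c) (λ i →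
    cong (λ b → δᶠ (loops i) w * ⟦ b ⟧)
         (trans (cong (λ m → positive (m mod⁺ ns i)) (moment-σ-difference D E i))
                (positive-mod⁺-neg (moment E i) (ns i))))

  marks-σ : ∀ D w → marks (σ D) w ≡ + 0
  marks-σ D w = ∑-zero (allFin c) _ (λ i →
    trans (cong (λ m → δᶠ (loops i) w * nonzero (m mod⁺ ns i)) (moment-σ D i))
          (trans (cong (λ r → δᶠ (loops i) w * nonzero r) (mod⁺-zero (ns i))) (ℤP.*-zeroʳ (δᶠ (loops i) w))))

  linSys⇔base : ∀ D → LinSysNonempty H (σ D) ⇔ G₀.HasEffective D
  linSys⇔base D = mk⇔
    (λ L → G₀.HasEffective-reflexive π-marks-σ
             (effective⇒base (σ D) (Equivalence.to (linSys⇔hasEffective sifting (σ D)) L)))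
    (λ L → Equivalence.from (linSys⇔hasEffective sifting (σ D))
             (base⇒effective (σ D) (G₀.HasEffective-reflexive (λ w → sym (π-marks-σ w)) L)))
    where
    π-marks-σ : ∀ w → π (σ D) w - marks (σ D) w ≡ D w
    π-marks-σ w = trans (cong₂ _-_ (π-σ D w) (marks-σ D w)) (ℤP.+-identityʳ (D w))

  -- Every effective E of degree k on H yields a test pair (π E, marked loops) on the base.
  base⇒rank : ∀ D k → BaseRankAtLeast N links loops D k → RankAtLeast H (σ D) k
  base⇒rank D k base E E≥0 degE =
    Equivalence.from (linSys⇔hasEffective sifting X)
      (base⇒effective X (G₀.HasEffective-reflexive adjust
        (base (π E) s (π-marks-nonneg E E≥0) (trans (sym (degree-π E)) degE))))
    where
    s : Fin c → Bool
    s i = positive (residue E i)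
    X : VH → ℤ
    X v = σ D v - E v
    adjust : ∀ w → D w - π E w - loopBases loops s w ≡ π X w - marks X w
    adjust w = sym (cong₂ _-_ (π-σ-difference D E w) (marks-σ-difference D E w))

  -- Conversely every test pair (E₀ , s) on the base is realised by an effective
  -- divisor of the same degree on H: the chips of the loops in s are moved to the
  -- first new vertex of their chain.  This needs every loop to be subdivided.
  rank⇒base : (∀ i → 1 ≤ ns i) → ∀ D k → RankAtLeast H (σ D) k → BaseRankAtLeast N links loops D k
  rank⇒base ns≥1 D k rank E₀ s E₀≥s degE₀ =
    G₀.HasEffective-reflexive adjust
      (effective⇒base X (Equivalence.to (linSys⇔hasEffective sifting X) (rank E E≥0 degE)))
    where
    E : VH → ℤ
    E (inj₁ w)       = E₀ w - loopBases loops s w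
    E (inj₂ (i , j)) = ⟦ s i ⟧ * δℕ (toℕ j) 0
    X : VH → ℤ
    X v = σ D v - E v

    E≥0 : ∀ v → + 0 ≤ᶻ E v
    E≥0 (inj₁ w)       = E₀≥s w
    E≥0 (inj₂ (i , j)) = *-nonneg (⟦⟧-nonneg (s i)) (δℕ-nonneg (toℕ j) 0)

    first-vertex : ∀ n → 1 ≤ n → (f : ℕ → ℤ) → f 0 ≡ + 1 →
                   ∑ (allFin n) (λ j → f (toℕ j) * δℕ (toℕ j) 0) ≡ + 1
    first-vertex (ℕ.suc m) _ f f0≡1 =
      trans (∑-toℕ (ℕ.suc m) (λ t → f t * δℕ t 0))
            (cong₂ _+_ (trans (ℤP.*-identityʳ (f 0)) f0≡1) (∑<-zero m _ (λ t → ℤP.*-zeroʳ (f (ℕ.suc t)))))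

    weighted-chip : ∀ i (f : ℕ → ℤ) → f 0 ≡ + 1 → ∑ (allFin (ns i)) (λ j → f (toℕ j) * E (new i j)) ≡ ⟦ s i ⟧
    weighted-chip i f f0≡1 =
      trans (∑-cong (allFin (ns i)) (λ j → reorder (f (toℕ j)) ⟦ s i ⟧ (δℕ (toℕ j) 0)))
            (trans (∑-*ˡ (allFin (ns i)) ⟦ s i ⟧ (λ j → f (toℕ j) * δℕ (toℕ j) 0))
                   (trans (cong (_*_ ⟦ s i ⟧) (first-vertex (ns i) (ns≥1 i) f f0≡1)) (ℤP.*-identityʳ ⟦ s i ⟧)))
      where reorder : ∀ a b c → a * (b * c) ≡ b * (a * c)
            reorder = solve-∀

    π-E : ∀ w → π E w ≡ E₀ w
    π-E w = trans (cong (_+_ (E₀ w - loopBases loops s w))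
                        (∑-cong (allFin c) (λ i → cong (_*_ (δᶠ (loops i) w))
                          (trans (∑-cong (allFin (ns i)) (λ j → sym (ℤP.*-identityˡ (E (new i j)))))
                                 (weighted-chip i (λ _ → + 1) refl)))))
                  (sub-add (E₀ w) (loopBases loops s w))
      where sub-add : ∀ a b → a - b + b ≡ a
            sub-add = solve-∀

    degE : deg H E ≡ + k
    degE = trans (degree-π E) (trans (∑-cong (allFin N) π-E) degE₀)

    marks-X : ∀ w → marks X w ≡ loopBases loops s w
    marks-X w = ∑-cong (allFin c) (λ i →
      cong (λ b → δᶠ (loops i) w * ⟦ b ⟧)
           (trans (cong (λ m → positive (m mod⁺ ns i))
                        (trans (moment-σ-difference D E i) (cong -_ (weighted-chip i (λ t → + ℕ.suc t) refl))))
                  (selected (s i) (ns i) (ns≥1 i))))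
      where
      selected : ∀ b n → 1 ≤ n → positive ((- ⟦ b ⟧) mod⁺ n) ≡ b
      selected true  (ℕ.suc m) _ = cong positive (mod⁺-minus-one (ℕ.suc m))
      selected false n         _ = cong positive (mod⁺-zero n)

    adjust : ∀ w → π X w - marks X w ≡ D w - E₀ w - loopBases loops s w
    adjust w = cong₂ _-_ (trans (π-σ-difference D E w) (cong (_-_ (D w)) (π-E w))) (marks-X w)

  rank⇔base : (∀ i → 1 ≤ ns i) → ∀ D k → RankAtLeast H (σ D) k ⇔ BaseRankAtLeast N links loops D k
  rank⇔base ns≥1 D k = mk⇔ (rank⇒base ns≥1 D k) (base⇒rank D k)

IsRank-transport : ∀ (G₁ G₂ : Graph) (X₁ : Div G₁) (X₂ : Div G₂) →
  (LinSysNonempty G₁ X₁ → LinSysNonempty G₂ X₂) → (LinSysNonempty G₂ X₂ → LinSysNonempty G₁ X₁) →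
  (∀ k → RankAtLeast G₁ X₁ k → RankAtLeast G₂ X₂ k) →
  (∀ k → RankAtLeast G₂ X₂ k → RankAtLeast G₁ X₁ k) →
  ∀ r → IsRank G₁ X₁ r → IsRank G₂ X₂ r
IsRank-transport _ _ _ _ to from rank-to rank-from r (inj₁ (r≡-1 , empty)) = inj₁ (r≡-1 , empty ∘ from)
IsRank-transport _ _ _ _ to from rank-to rank-from r (inj₂ (k , r≡k , L , R , maximal)) =
  inj₂ (k , r≡k , to L , rank-to k R , λ k′ k<k′ R′ → maximal k′ k<k′ (rank-from k′ R′))

IsRank-cong : ∀ (G₁ G₂ : Graph) (X₁ : Div G₁) (X₂ : Div G₂) →
  LinSysNonempty G₁ X₁ ⇔ LinSysNonempty G₂ X₂ → (∀ k → RankAtLeast G₁ X₁ k ⇔ RankAtLeast G₂ X₂ k) →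
  ∀ r → IsRank G₁ X₁ r ⇔ IsRank G₂ X₂ r
IsRank-cong G₁ G₂ X₁ X₂ L R r = mk⇔
  (IsRank-transport G₁ G₂ X₁ X₂ (Equivalence.to L) (Equivalence.from L)
                                (Equivalence.to ∘ R) (Equivalence.from ∘ R) r)
  (IsRank-transport G₂ G₁ X₂ X₁ (Equivalence.from L) (Equivalence.to L)
                                (Equivalence.from ∘ R) (Equivalence.to ∘ R) r)

proposition3p4 : (N : ℕ) (links : List (Fin N × Fin N)) (c : ℕ) (loops : Fin c → Fin N)
    → All (λ e → proj₁ e ≢ proj₂ e) links
    → Connected (baseGraph N links loops)
    → (ns : Fin c → ℕ) → (∀ i → 1 ≤ ns i)
    → (D : Fin N → ℤ) (r : ℤ)
    → IsRankSharp N links loops D r ⇔ IsRank (subdivide N links loops ns) (σ* D) r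
proposition3p4 N links c loops _ _ ns ns≥1 D r =
  IsRank-cong (hatGraph N links loops) (subdivide N links loops ns) (σ* D) (σ* D)
              (⇔.trans (Ĝ.linSys⇔base D) (⇔.sym (Gⁿ.linSys⇔base D)))
              (λ k → ⇔.trans (Ĝ.rank⇔base (λ _ → ℕ.s≤s ℕ.z≤n) D k) (⇔.sym (Gⁿ.rank⇔base ns≥1 D k)))
              r
  where
  module Ĝ  = Subdivision N links loops (λ _ → 1)
  module Gⁿ = Subdivision N links loops ns
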